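{- Let $k,n\geq 0$ be integers, and for each $i$ with $1\leq i\leq k+1$ let $p_i\geq 5$ be a prime with $p_i\not\equiv 1\pmod 8$. Then for every integer $j\not\equiv 0\pmod{p_{k+1}}$, \[ T_2\Big(9p_1^2\cdots p_{k+1}^2n + \frac{9p_1^2\cdots p_{k}^2p_{k+1}(8j+p_{k+1})-1}{8}\Big) \equiv 0 \pmod{6}. \]
   Context: A partition is $2$-regular if none of its parts is even. $T_2(n)$ denotes the number of triples $(\xi_1,\xi_2,\xi_3)$ of $2$-regular partitions whose sizes sum to $n$; equivalently \[ \sum_{n\geq 0}T_2(n)q^n=\prod_{i\geq 1}\frac{(1-q^{2i})^3}{(1-q^i)^3}. \] -}

module Defs where

open import Data.Nat using (ℕ; zero; suc; _+_; _*_; _∸_; _≤?_)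
open import Data.Bool using (if_then_else_)
open import Data.List using (List; map; upTo)
open import Data.Nat.ListAction using (sum)
open import Data.Vec using (Vec; foldr)
open import Data.Integer as ℤ using (ℤ; +_; -[1+_])
open import Relation.Nullary.Decidable using (⌊_⌋)

-- oddCount m r = number of partitions of r all of whose parts lie in
-- {1, 3, ..., 2m-1} (odd parts of size at most 2m-1).
-- Recursion: choose the multiplicity t of the part 2m+1.
oddCount : ℕ → ℕ → ℕ
oddCount zero zero = 1
oddCount zero (suc _) = 0
oddCount (suc m) r =
  sum (map (λ t → if ⌊ t * (2 * m + 1) ≤? r ⌋
                    then oddCount m (r ∸ t * (2 * m + 1))
                    else 0)
           (upTo (suc r)))

-- number of 2-regular partitions of r (partitions of r with no even part,
-- i.e. all parts odd); every part is ≤ r ≤ 2r-1 when r ≥ 1.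
reg2 : ℕ → ℕ
reg2 r = oddCount r r

T2 : ℕ → ℕ
T2 n = sum (map (λ a → sum (map (λ b → reg2 a * reg2 b * reg2 ((n ∸ a) ∸ b))
                                (upTo (suc (n ∸ a)))))
                (upTo (suc n)))

-- T₂ extended to integer arguments: 0 for negative arguments
-- (coefficient of q^N in the generating function).
T2ℤ : ℤ → ℕ
T2ℤ (+ n) = T2 n
T2ℤ -[1+ _ ] = 0

prodV : ∀ {k} → Vec ℕ k → ℕ
prodV = foldr _ _*_ 1

-- All series are power series truncated at some degree N, with coefficients in ℕ compared
-- modulo 2 or 3.  Put f = ∏ᵢ (1 - q^(2i+1)); Euler's identity f · ∑ reg2(n) qⁿ = 1 gives
-- f³ · ∑ T₂(n) qⁿ = 1.
-- Modulo 3, f³ ≡ ∏ᵢ (1 - q^(3(2i+1))) is a series in q³, hence so is ∑ T₂(n) qⁿ: 3 ∣ T₂(N)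
-- unless 3 ∣ N.
-- Modulo 2, the finite Jacobi triple product ∏ᵢ (1 + z q^(4i+1)) (1 + z⁻¹ q^(4i+3)) satisfies a
-- functional equation under z ↦ z q⁴, so its coefficient of z^k is q^(k(2k-1)) times its constant
-- term.  Evaluating at z = q determines the constant term, and at z = 1 it gives
-- f ≡ ψ · ∏ᵢ (1 - q^(4(2i+1))) ≡ ψ f⁴ with ψ = ∑ₖ q^(k(2k-1)).  Hence ∑ T₂(n) qⁿ ≡ ψ, and T₂(N) is
-- even unless 8N + 1 = (4k - 1)² is a square.
-- Under the hypotheses 8N + 1 = (3 p₁⋯pₖ)² p_{k+1} y with p_{k+1} ∤ y: it is not a square, and
-- 3 ∣ 8N + 1 forces 3 ∤ N.

module Submission where

open import Defs
open import Data.Nat using (ℕ; _≤_; _%_; _^_; _*_)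
open import Data.Nat.Primality using (Prime)
open import Data.Nat.Divisibility using (_∣_)
open import Data.Vec using (Vec)
open import Data.Vec.Relation.Unary.All using (All)
open import Data.Product using (_×_)
open import Data.Integer as ℤ using (ℤ; +_)
open import Data.Integer.Divisibility as ℤD using ()
open import Relation.Binary.PropositionalEquality using (_≡_)
open import Relation.Nullary using (¬_)

open import Data.Nat using (zero; suc; _+_; _∸_; _<_; z≤n; s≤s; _≤?_; NonZero)
open import Data.Nat.Properties
open import Algebra.Properties.CommutativeSemigroup +-commutativeSemigroup using () renaming (interchange to +-interchange)
open import Data.Nat.DivMod using (%-distribˡ-+; %-distribˡ-*; [m+kn]%n≡m%n)
open import Data.Nat.Divisibility using (divides; _∣0; ∣m∣n⇒∣m+n; m∣m*n; n∣m*n; ∣-trans; ∣⇒≤; ∣m+n∣m⇒∣n; ∣1⇒≡1; m%n≡0⇒n∣m; n∣m⇒m%n≡0)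
open import Data.Nat.Primality using (euclidsLemma; prime⇒nonZero; prime[2]; prime?)
open import Data.Nat.Induction using (<-rec)
open import Data.Nat.GeneralisedArithmetic using (fold)
open import Data.Nat.ListAction using (sum)
open import Data.Nat.Solver using (module +-*-Solver)
open import Data.Integer using (-[1+_]; 0ℤ; 1ℤ; -1ℤ)
import Data.Integer.Properties as ℤP
import Data.Integer.Divisibility.Signed as ℤS
import Data.Integer.Solver as ℤSolver
open import Data.List using (map; upTo; applyUpTo)
open import Data.Bool using (if_then_else_)
open import Data.Vec using ([]; _∷_)
open import Data.Vec.Relation.Unary.All using ([]; _∷_)
import Data.Vec.Relation.Unary.All as All
open import Data.Product using (Σ; _,_; proj₁; proj₂)
open import Data.Sum using (_⊎_; inj₁; inj₂; [_,_]′)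
open import Function using (_∘_)
open import Level using (0ℓ)
open import Relation.Nullary using (yes; no; contradiction)
open import Relation.Nullary.Decidable using (⌊_⌋; toWitness)
open import Relation.Binary.PropositionalEquality
open import Relation.Binary.Bundles using (Setoid)
import Relation.Binary.Reasoning.Setoid as ≈-Reasoning

-[1+k]-a≡-[1+k+a] : ∀ k a → -[1+ k ] ℤ.- + a ≡ -[1+ (k + a) ]
-[1+k]-a≡-[1+k+a] k zero = cong -[1+_] (sym (+-identityʳ k))
-[1+k]-a≡-[1+k+a] k (suc a) = cong -[1+_] (sym (+-suc k a))

n-a≡+[n∸a] : ∀ {n a} → a ≤ n → + n ℤ.- + a ≡ + (n ∸ a)
n-a≡+[n∸a] {n} {a} a≤n = trans (ℤP.m-n≡m⊖n n a) (ℤP.⊖-≥ a≤n)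

n-a≡-[1+a∸1+n] : ∀ {n a} → n < a → + n ℤ.- + a ≡ -[1+ (a ∸ suc n) ]
n-a≡-[1+a∸1+n] {n} {suc a} (s≤s n≤a) =
  trans (ℤP.m-n≡m⊖n n (suc a)) (trans (ℤP.⊖-< (s≤s n≤a)) (cong (λ x → ℤ.- (+ x)) (+-∸-assoc 1 n≤a)))

ℤ-minus-comm : ∀ n a b → n ℤ.- a ℤ.- b ≡ n ℤ.- b ℤ.- a
ℤ-minus-comm = solve 3 (λ n a b → n :- a :- b := n :- b :- a) refl
  where open ℤSolver.+-*-Solver

Σ< : ℕ → (ℕ → ℕ) → ℕ
Σ< zero h = 0
Σ< (suc L) h = h 0 + Σ< L (λ i → h (suc i))

Σ<-cong : ∀ L {h h'} → (∀ i → i < L → h i ≡ h' i) → Σ< L h ≡ Σ< L h'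
Σ<-cong zero e = refl
Σ<-cong (suc L) e = cong₂ _+_ (e 0 (s≤s z≤n)) (Σ<-cong L (λ i i<L → e (suc i) (s≤s i<L)))

Σ<-+ : ∀ L h h' → Σ< L (λ i → h i + h' i) ≡ Σ< L h + Σ< L h'
Σ<-+ zero h h' = refl
Σ<-+ (suc L) h h' rewrite Σ<-+ L (λ i → h (suc i)) (λ i → h' (suc i)) =
  +-interchange (h 0) (h' 0) (Σ< L (λ i → h (suc i))) (Σ< L (λ i → h' (suc i)))

Σ<-*ˡ : ∀ L x h → Σ< L (λ i → x * h i) ≡ x * Σ< L h
Σ<-*ˡ zero x h = sym (*-zeroʳ x)
Σ<-*ˡ (suc L) x h rewrite Σ<-*ˡ L x (λ i → h (suc i)) = sym (*-distribˡ-+ x (h 0) _)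

Σ<-zero : ∀ L h → (∀ i → i < L → h i ≡ 0) → Σ< L h ≡ 0
Σ<-zero zero h e = refl
Σ<-zero (suc L) h e = cong₂ _+_ (e 0 (s≤s z≤n)) (Σ<-zero L _ (λ i i<L → e (suc i) (s≤s i<L)))

data MinusView (n a : ℕ) : ℤ → Set where
  ≥-view : a ≤ n → MinusView n a (+ (n ∸ a))
  <-view : ∀ {k} → n < a → MinusView n a -[1+ k ]

minus-view : ∀ n a → MinusView n a (+ n ℤ.- + a)
minus-view n a with a ≤? n
... | yes a≤n = subst (MinusView n a) (sym (n-a≡+[n∸a] a≤n)) (≥-view a≤n)
... | no a≰n = subst (MinusView n a) (sym (n-a≡-[1+a∸1+n] (≰⇒> a≰n))) (<-view (≰⇒> a≰n))

-- Formal power series in q with natural coefficients, indexed by ℤ so that shifting by q^a is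
-- just reindexing; negative coefficients vanish.
record Series : Set where
  constructor series
  field
    _⟨_⟩ : ℤ → ℕ
    negative-coeff≡0 : ∀ k → _⟨_⟩ -[1+ k ] ≡ 0
open Series public

infix 4 _≐_
record _≐_ (f g : Series) : Set where
  constructor mk≐
  field ≐-at : ∀ n → f ⟨ n ⟩ ≡ g ⟨ n ⟩
open _≐_ public

≐-setoid : Setoid 0ℓ 0ℓ
≐-setoid = record
  { Carrier = Series ; _≈_ = _≐_
  ; isEquivalence = record
    { refl = mk≐ λ _ → refl
    ; sym = λ (mk≐ e) → mk≐ λ n → sym (e n)
    ; trans = λ (mk≐ e) (mk≐ e') → mk≐ λ n → trans (e n) (e' n) } }

open Setoid ≐-setoid public using () renaming (refl to ≐-refl; sym to ≐-sym; trans to ≐-trans)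

𝟙 : Series
𝟙 = series coeff (λ _ → refl)
  where
  coeff : ℤ → ℕ
  coeff (+ zero) = 1
  coeff (+ suc _) = 0
  coeff -[1+ _ ] = 0

shift : ℕ → Series → Series
shift a f = series (λ n → f ⟨ n ℤ.- + a ⟩)
  (λ k → trans (cong (f ⟨_⟩) (-[1+k]-a≡-[1+k+a] k a)) (negative-coeff≡0 f (k + a)))

shift-cong : ∀ a {f g} → f ≐ g → shift a f ≐ shift a g
shift-cong a (mk≐ e) = mk≐ λ n → e (n ℤ.- + a)

shift-zero : ∀ f → shift 0 f ≐ f
shift-zero f = mk≐ λ n → cong (f ⟨_⟩) (ℤP.+-identityʳ n)

shift-suc : ∀ a f → shift (suc a) f ≐ shift 1 (shift a f)
shift-suc a f = mk≐ λ n → cong (f ⟨_⟩) (lemma n (+ a))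
  where
  open ℤSolver.+-*-Solver
  lemma : ∀ n x → n ℤ.- (+ 1 ℤ.+ x) ≡ n ℤ.- + 1 ℤ.- x
  lemma = solve 2 (λ n x → n :- (con (+ 1) :+ x) := n :- con (+ 1) :- x) refl

infixl 7 _⋆_
_⋆_ : Series → Series → Series
f ⋆ g = series coeff (λ _ → refl)
  where
  coeff : ℤ → ℕ
  coeff (+ n) = Σ< (suc n) λ i → f ⟨ + i ⟩ * g ⟨ + (n ∸ i) ⟩
  coeff -[1+ _ ] = 0

⋆-congˡ : ∀ {f f'} g → f ≐ f' → f ⋆ g ≐ f' ⋆ g
⋆-congˡ {f} {f'} g (mk≐ f≐f') = mk≐ at
  where
  at : ∀ n → (f ⋆ g) ⟨ n ⟩ ≡ (f' ⋆ g) ⟨ n ⟩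
  at (+ n) = Σ<-cong (suc n) (λ i _ → cong (λ x → x * g ⟨ + (n ∸ i) ⟩) (f≐f' (+ i)))
  at -[1+ _ ] = refl

𝟙-⋆ : ∀ g → 𝟙 ⋆ g ≐ g
𝟙-⋆ g = mk≐ at
  where
  at : ∀ n → (𝟙 ⋆ g) ⟨ n ⟩ ≡ g ⟨ n ⟩
  at (+ n) = trans (cong₂ _+_ (+-identityʳ (g ⟨ + n ⟩)) (Σ<-zero n _ (λ _ _ → refl))) (+-identityʳ _)
  at -[1+ k ] = sym (negative-coeff≡0 g k)

shift1-⋆ : ∀ f g → shift 1 f ⋆ g ≐ shift 1 (f ⋆ g)
shift1-⋆ f g = mk≐ at
  where
  at : ∀ n → (shift 1 f ⋆ g) ⟨ n ⟩ ≡ shift 1 (f ⋆ g) ⟨ n ⟩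
  at (+ zero) rewrite negative-coeff≡0 f 0 = refl
  at (+ suc n) rewrite negative-coeff≡0 f 0 =
    Σ<-cong (suc n) (λ i _ → cong (λ j → f ⟨ j ⟩ * g ⟨ + (n ∸ i) ⟩) (n-a≡+[n∸a] (s≤s (z≤n {i}))))
  at -[1+ _ ] = refl

shift-⋆ : ∀ a f g → shift a f ⋆ g ≐ shift a (f ⋆ g)
shift-⋆ zero f g = ≐-trans (⋆-congˡ g (shift-zero f)) (≐-sym (shift-zero (f ⋆ g)))
shift-⋆ (suc a) f g = begin
  shift (suc a) f ⋆ g        ≈⟨ ⋆-congˡ g (shift-suc a f) ⟩
  shift 1 (shift a f) ⋆ g    ≈⟨ shift1-⋆ (shift a f) g ⟩
  shift 1 (shift a f ⋆ g)    ≈⟨ shift-cong 1 (shift-⋆ a f g) ⟩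
  shift 1 (shift a (f ⋆ g))  ≈⟨ shift-suc a (f ⋆ g) ⟨
  shift (suc a) (f ⋆ g)      ∎
  where open ≈-Reasoning ≐-setoid

module _ (A B : Series → Series) (A-cong : ∀ {f g} → f ≐ g → A f ≐ A g) (B-cong : ∀ {f g} → f ≐ g → B f ≐ B g)
         (BA≐AB : ∀ f → B (A f) ≐ A (B f)) where

  fold-commute : ∀ p f → B (fold f A p) ≐ fold (B f) A p
  fold-commute zero f = ≐-refl
  fold-commute (suc p) f = ≐-trans (BA≐AB _) (A-cong (fold-commute p f))

  fold-∘ : ∀ p f → fold f (λ g → A (B g)) p ≐ fold (fold f B p) A p
  fold-∘ zero f = ≐-refl
  fold-∘ (suc p) f = ≐-trans (A-cong (B-cong (fold-∘ p f))) (A-cong (fold-commute p _))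

fold-id : ∀ p f → fold f (λ g → g) p ≐ f
fold-id zero f = ≐-refl
fold-id (suc p) f = fold-id p f

-- Coefficients are read modulo suc c, so c * x stands for - x and ×[1-q^ a ] multiplies by 1 - q^a.
module Mod (c : ℕ) where

  modulus : ℕ
  modulus = suc c

  infix 4 _≋_
  record _≋_ (x y : ℕ) : Set where
    constructor mk≋
    field %-≡ : x % modulus ≡ y % modulus
  open _≋_ public

  ≋-reflexive : ∀ {x y} → x ≡ y → x ≋ y
  ≋-reflexive refl = mk≋ refl

  ≋-refl : ∀ {x} → x ≋ x
  ≋-refl = mk≋ refl

  ≋-sym : ∀ {x y} → x ≋ y → y ≋ x
  ≋-sym (mk≋ e) = mk≋ (sym e)

  ≋-trans : ∀ {x y z} → x ≋ y → y ≋ z → x ≋ z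
  ≋-trans (mk≋ e) (mk≋ e') = mk≋ (trans e e')

  ≋-setoid : Setoid 0ℓ 0ℓ
  ≋-setoid = record
    { Carrier = ℕ ; _≈_ = _≋_
    ; isEquivalence = record { refl = ≋-refl ; sym = ≋-sym ; trans = ≋-trans } }

  ≋-+ : ∀ {a a' b b'} → a ≋ a' → b ≋ b' → a + b ≋ a' + b'
  ≋-+ {a} {a'} {b} {b'} (mk≋ a≋a') (mk≋ b≋b') = mk≋ (begin
    (a + b) % modulus                            ≡⟨ %-distribˡ-+ a b modulus ⟩
    (a % modulus + b % modulus) % modulus        ≡⟨ cong₂ (λ x y → (x + y) % modulus) a≋a' b≋b' ⟩
    (a' % modulus + b' % modulus) % modulus      ≡⟨ %-distribˡ-+ a' b' modulus ⟨
    (a' + b') % modulus                          ∎)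
    where open ≡-Reasoning

  ≋-* : ∀ {a a' b b'} → a ≋ a' → b ≋ b' → a * b ≋ a' * b'
  ≋-* {a} {a'} {b} {b'} (mk≋ a≋a') (mk≋ b≋b') = mk≋ (begin
    (a * b) % modulus                            ≡⟨ %-distribˡ-* a b modulus ⟩
    (a % modulus * (b % modulus)) % modulus      ≡⟨ cong₂ (λ x y → (x * y) % modulus) a≋a' b≋b' ⟩
    (a' % modulus * (b' % modulus)) % modulus    ≡⟨ %-distribˡ-* a' b' modulus ⟨
    (a' * b') % modulus                          ∎)
    where open ≡-Reasoning

  x+y*modulus≋x : ∀ x y → x + y * modulus ≋ x
  x+y*modulus≋x x y = mk≋ ([m+kn]%n≡m%n x y modulus)

  x+y+cy≋x : ∀ x y → x + y + c * y ≋ x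
  x+y+cy≋x x y = ≋-trans (≋-reflexive (trans (+-assoc x y (c * y)) (cong (_+_ x) (*-comm (suc c) y))))
                         (x+y*modulus≋x x y)

  ≋-cancelʳ-+ : ∀ {x x' y y'} → x + y ≋ x' + y' → y ≋ y' → x ≋ x'
  ≋-cancelʳ-+ {x} {x'} {y} {y'} e y≋y' = begin
    x                ≈⟨ x+y+cy≋x x y ⟨
    x + y + c * y    ≈⟨ ≋-+ e (≋-* (≋-refl {c}) y≋y') ⟩
    x' + y' + c * y' ≈⟨ x+y+cy≋x x' y' ⟩
    x'               ∎
    where open ≈-Reasoning ≋-setoid

  infixl 6 _⊝_
  _⊝_ : Series → Series → Series
  f ⊝ g = series (λ n → f ⟨ n ⟩ + c * g ⟨ n ⟩)
    (λ k → trans (cong₂ (λ x y → x + c * y) (negative-coeff≡0 f k) (negative-coeff≡0 g k)) (*-zeroʳ c))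

  ×[1-q^_]_ : ℕ → Series → Series
  ×[1-q^ a ] f = f ⊝ shift a f

  infix 4 _≈[_]_
  record _≈[_]_ (f : Series) (N : ℕ) (g : Series) : Set where
    constructor mk≈
    field ≈-at : ∀ n → n ≤ N → f ⟨ + n ⟩ ≋ g ⟨ + n ⟩
  open _≈[_]_ public

  ≈-setoid : ℕ → Setoid 0ℓ 0ℓ
  ≈-setoid N = record
    { Carrier = Series ; _≈_ = _≈[ N ]_
    ; isEquivalence = record
      { refl = mk≈ λ _ _ → ≋-refl
      ; sym = λ (mk≈ e) → mk≈ λ n n≤N → ≋-sym (e n n≤N)
      ; trans = λ (mk≈ e) (mk≈ e') → mk≈ λ n n≤N → ≋-trans (e n n≤N) (e' n n≤N) } }

  module _ {N : ℕ} where
    open Setoid (≈-setoid N) public using () renaming (refl to ≈-refl; sym to ≈-sym; trans to ≈-trans)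

  ≐⇒≈ : ∀ {f g N} → f ≐ g → f ≈[ N ] g
  ≐⇒≈ (mk≐ e) = mk≈ λ n _ → ≋-reflexive (e (+ n))

  negative-coeffs-agree : ∀ f g k → f ⟨ -[1+ k ] ⟩ ≋ g ⟨ -[1+ k ] ⟩
  negative-coeffs-agree f g k = ≋-reflexive (trans (negative-coeff≡0 f k) (sym (negative-coeff≡0 g k)))

  shift-resp-≈ : ∀ a {f g N} → f ≈[ N ] g → shift a f ≈[ N ] shift a g
  shift-resp-≈ a {f} {g} {N} (mk≈ e) = mk≈ at
    where
    at : ∀ n → n ≤ N → f ⟨ + n ℤ.- + a ⟩ ≋ g ⟨ + n ℤ.- + a ⟩
    at n n≤N with + n ℤ.- + a | minus-view n a
    ... | _ | ≥-view _ = e (n ∸ a) (≤-trans (m∸n≤m n a) n≤N)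
    ... | -[1+ k ] | <-view _ = negative-coeffs-agree f g k

  ⊝-resp-≈ : ∀ {f f' g g' N} → f ≈[ N ] f' → g ≈[ N ] g' → f ⊝ g ≈[ N ] f' ⊝ g'
  ⊝-resp-≈ (mk≈ e) (mk≈ e') = mk≈ λ n n≤N → ≋-+ (e n n≤N) (≋-* (≋-refl {c}) (e' n n≤N))

  ×-resp-≈ : ∀ a {f g N} → f ≈[ N ] g → ×[1-q^ a ] f ≈[ N ] ×[1-q^ a ] g
  ×-resp-≈ a f≈g = ⊝-resp-≈ f≈g (shift-resp-≈ a f≈g)

  ⊝-cong : ∀ {f f' g g'} → f ≐ f' → g ≐ g' → f ⊝ g ≐ f' ⊝ g'
  ⊝-cong (mk≐ e) (mk≐ e') = mk≐ λ n → cong₂ (λ x y → x + c * y) (e n) (e' n)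

  ×-cong : ∀ a {f g} → f ≐ g → ×[1-q^ a ] f ≐ ×[1-q^ a ] g
  ×-cong a f≐g = ⊝-cong f≐g (shift-cong a f≐g)

  ×-comm : ∀ a b f → ×[1-q^ a ] (×[1-q^ b ] f) ≐ ×[1-q^ b ] (×[1-q^ a ] f)
  ×-comm a b f = mk≐ at
    where
    open +-*-Solver
    swap : ∀ x y z w → x + c * y + c * (z + c * w) ≡ x + c * z + c * (y + c * w)
    swap = solve 5 (λ c x y z w → x :+ c :* y :+ c :* (z :+ c :* w) := x :+ c :* z :+ c :* (y :+ c :* w)) refl c
    at : ∀ n → (×[1-q^ a ] (×[1-q^ b ] f)) ⟨ n ⟩ ≡ (×[1-q^ b ] (×[1-q^ a ] f)) ⟨ n ⟩
    at n rewrite ℤ-minus-comm n (+ a) (+ b) = swap (f ⟨ n ⟩) (f ⟨ n ℤ.- + b ⟩) (f ⟨ n ℤ.- + a ⟩) (f ⟨ n ℤ.- + b ℤ.- + a ⟩)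

  ×-cancel : ∀ a {f g N} → 1 ≤ a → ×[1-q^ a ] f ≈[ N ] ×[1-q^ a ] g → f ≈[ N ] g
  ×-cancel a {f} {g} {N} 1≤a (mk≈ e) = mk≈ (<-rec _ agree)
    where
    agree : ∀ n → (∀ {m} → m < n → m ≤ N → f ⟨ + m ⟩ ≋ g ⟨ + m ⟩) → n ≤ N → f ⟨ + n ⟩ ≋ g ⟨ + n ⟩
    agree n ih n≤N = ≋-cancelʳ-+ (e n n≤N) (≋-* (≋-refl {c}) (earlier (minus-view n a)))
      where
      earlier : ∀ {i} → MinusView n a i → f ⟨ i ⟩ ≋ g ⟨ i ⟩
      earlier (≥-view a≤n) = ih (∸-monoʳ-< 1≤a a≤n) (≤-trans (m∸n≤m n a) n≤N)
      earlier {i = -[1+ k ]} (<-view _) = negative-coeffs-agree f g k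

  ×-below : ∀ a {f N} → N < a → ×[1-q^ a ] f ≈[ N ] f
  ×-below a {f} N<a = mk≈ λ n n≤N →
    ≋-reflexive (trans (cong (λ i → f ⟨ + n ⟩ + c * f ⟨ i ⟩) (n-a≡-[1+a∸1+n] (≤-<-trans n≤N N<a)))
                (trans (cong (λ x → f ⟨ + n ⟩ + c * x) (negative-coeff≡0 f _))
                (trans (cong (_+_ (f ⟨ + n ⟩)) (*-zeroʳ c)) (+-identityʳ _))))

  Σ<-resp-≋ : ∀ L {h h'} → (∀ i → i < L → h i ≋ h' i) → Σ< L h ≋ Σ< L h'
  Σ<-resp-≋ zero e = ≋-refl
  Σ<-resp-≋ (suc L) e = ≋-+ (e 0 (s≤s z≤n)) (Σ<-resp-≋ L (λ i i<L → e (suc i) (s≤s i<L)))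

  ⋆-resp-≈ˡ : ∀ {f f' N} g → f ≈[ N ] f' → f ⋆ g ≈[ N ] f' ⋆ g
  ⋆-resp-≈ˡ {f} {f'} g (mk≈ e) = mk≈ λ n n≤N →
    Σ<-resp-≋ (suc n) {λ i → f ⟨ + i ⟩ * g ⟨ + (n ∸ i) ⟩} {λ i → f' ⟨ + i ⟩ * g ⟨ + (n ∸ i) ⟩}
      (λ i i≤n → ≋-* (e i (≤-trans (≤-pred i≤n) n≤N)) ≋-refl)

  ⊝-⋆ : ∀ f h g → (f ⊝ h) ⋆ g ≐ f ⋆ g ⊝ h ⋆ g
  ⊝-⋆ f h g = mk≐ at
    where
    at : ∀ n → ((f ⊝ h) ⋆ g) ⟨ n ⟩ ≡ (f ⋆ g ⊝ h ⋆ g) ⟨ n ⟩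
    at (+ n) = begin
      Σ< (suc n) (λ i → (f ⟨ + i ⟩ + c * h ⟨ + i ⟩) * g ⟨ + (n ∸ i) ⟩)
        ≡⟨ Σ<-cong (suc n) (λ i _ → distrib (f ⟨ + i ⟩) (h ⟨ + i ⟩) (g ⟨ + (n ∸ i) ⟩)) ⟩
      Σ< (suc n) (λ i → f ⟨ + i ⟩ * g ⟨ + (n ∸ i) ⟩ + c * (h ⟨ + i ⟩ * g ⟨ + (n ∸ i) ⟩))
        ≡⟨ Σ<-+ (suc n) (λ i → f ⟨ + i ⟩ * g ⟨ + (n ∸ i) ⟩) (λ i → c * (h ⟨ + i ⟩ * g ⟨ + (n ∸ i) ⟩)) ⟩
      (f ⋆ g) ⟨ + n ⟩ + Σ< (suc n) (λ i → c * (h ⟨ + i ⟩ * g ⟨ + (n ∸ i) ⟩))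
        ≡⟨ cong (_+_ ((f ⋆ g) ⟨ + n ⟩)) (Σ<-*ˡ (suc n) c (λ i → h ⟨ + i ⟩ * g ⟨ + (n ∸ i) ⟩)) ⟩
      (f ⋆ g) ⟨ + n ⟩ + c * (h ⋆ g) ⟨ + n ⟩ ∎
      where
      open ≡-Reasoning
      distrib : ∀ x y z → (x + c * y) * z ≡ x * z + c * (y * z)
      distrib = solve 4 (λ c x y z → (x :+ c :* y) :* z := x :* z :+ c :* (y :* z)) refl c
        where open +-*-Solver
    at -[1+ _ ] = sym (*-zeroʳ c)

  ×-⋆ : ∀ a f g → (×[1-q^ a ] f) ⋆ g ≐ ×[1-q^ a ] (f ⋆ g)
  ×-⋆ a f g = ≐-trans (⊝-⋆ f (shift a f) g) (⊝-cong ≐-refl (shift-⋆ a f g))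

  ×∏[1-q^_<_]_ : (ℕ → ℕ) → ℕ → Series → Series
  ×∏[1-q^ e < zero ] f = f
  ×∏[1-q^ e < suc K ] f = ×[1-q^ e K ] (×∏[1-q^ e < K ] f)

  module _ (e : ℕ → ℕ) where

    ∏-resp-≈ : ∀ K {f g N} → f ≈[ N ] g → ×∏[1-q^ e < K ] f ≈[ N ] ×∏[1-q^ e < K ] g
    ∏-resp-≈ zero f≈g = f≈g
    ∏-resp-≈ (suc K) f≈g = ×-resp-≈ (e K) (∏-resp-≈ K f≈g)

    ∏-cong : ∀ K {f g} → f ≐ g → ×∏[1-q^ e < K ] f ≐ ×∏[1-q^ e < K ] g
    ∏-cong zero f≐g = f≐g
    ∏-cong (suc K) f≐g = ×-cong (e K) (∏-cong K f≐g)

    ∏-natural : (A : Series → Series) → (∀ {f g} → f ≐ g → A f ≐ A g) →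
                (∀ a f → A (×[1-q^ a ] f) ≐ ×[1-q^ a ] (A f)) →
                ∀ K f → A (×∏[1-q^ e < K ] f) ≐ ×∏[1-q^ e < K ] (A f)
    ∏-natural A A-cong A-× zero f = ≐-refl
    ∏-natural A A-cong A-× (suc K) f =
      ≐-trans (A-× (e K) _) (×-cong (e K) (∏-natural A A-cong A-× K f))

    ∏-cancel : (∀ i → 1 ≤ e i) → ∀ K {f g N} → ×∏[1-q^ e < K ] f ≈[ N ] ×∏[1-q^ e < K ] g → f ≈[ N ] g
    ∏-cancel 1≤e zero e≈ = e≈
    ∏-cancel 1≤e (suc K) e≈ = ∏-cancel 1≤e K (×-cancel (e K) (1≤e K) e≈)

    ∏-below : ∀ K j {f N} → (∀ i → K ≤ i → N < e i) → ×∏[1-q^ e < j + K ] f ≈[ N ] ×∏[1-q^ e < K ] f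
    ∏-below K zero N<e = ≈-refl
    ∏-below K (suc j) N<e = ≈-trans (×-below (e (j + K)) (N<e (j + K) (m≤n+m K j))) (∏-below K j N<e)

  fold-cancel : ∀ {A : Series → Series} {N} → (∀ {f g} → A f ≈[ N ] A g → f ≈[ N ] g) →
                ∀ p {f g} → fold f A p ≈[ N ] fold g A p → f ≈[ N ] g
  fold-cancel A-cancel zero e = e
  fold-cancel A-cancel (suc p) e = fold-cancel A-cancel p (A-cancel e)

  ∏-frobenius : ∀ p → (∀ a f {N} → fold f ×[1-q^ a ]_ p ≈[ N ] ×[1-q^ p * a ] f) →
                ∀ e K f {N} → fold f ×∏[1-q^ e < K ]_ p ≈[ N ] ×∏[1-q^ (λ i → p * e i) < K ] f
  ∏-frobenius p frob e zero f = ≐⇒≈ (fold-id p f)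
  ∏-frobenius p frob e (suc K) f {N} = begin
    fold f ×∏[1-q^ e < suc K ]_ p                   ≈⟨ ≐⇒≈ (fold-∘ ×[1-q^ e K ]_ ×∏[1-q^ e < K ]_ (×-cong (e K)) (∏-cong e K)
                                                                  (λ g → ≐-sym (∏-natural e ×[1-q^ e K ]_ (×-cong (e K)) (×-comm (e K)) K g)) p f) ⟩
    fold (fold f ×∏[1-q^ e < K ]_ p) ×[1-q^ e K ]_ p ≈⟨ frob (e K) _ ⟩
    ×[1-q^ p * e K ] (fold f ×∏[1-q^ e < K ]_ p)      ≈⟨ ×-resp-≈ (p * e K) (∏-frobenius p frob e K f) ⟩
    ×∏[1-q^ (λ i → p * e i) < suc K ] f              ∎
    where open ≈-Reasoning (≈-setoid N)

  VanishesOffMultiplesOf : ℕ → ℕ → Series → Set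
  VanishesOffMultiplesOf d N h = ∀ n → n ≤ N → ¬ d ∣ n → h ⟨ + n ⟩ ≋ 0

  𝟙-vanishes-off-multiples : ∀ d N → VanishesOffMultiplesOf d N 𝟙
  𝟙-vanishes-off-multiples d N zero _ d∤0 = contradiction (d ∣0) d∤0
  𝟙-vanishes-off-multiples d N (suc n) _ _ = ≋-refl

  vanishes-resp-≈ : ∀ {d N f g} → f ≈[ N ] g → VanishesOffMultiplesOf d N g → VanishesOffMultiplesOf d N f
  vanishes-resp-≈ (mk≈ e) vg n n≤N d∤n = ≋-trans (e n n≤N) (vg n n≤N d∤n)

  ×-vanishes⁻¹ : ∀ {d N} a h → d ∣ a → 1 ≤ a →
                 VanishesOffMultiplesOf d N (×[1-q^ a ] h) → VanishesOffMultiplesOf d N h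
  ×-vanishes⁻¹ {d} {N} a h d∣a 1≤a v = <-rec _ vanish
    where
    vanish : ∀ n → (∀ {m} → m < n → m ≤ N → ¬ d ∣ m → h ⟨ + m ⟩ ≋ 0) → n ≤ N → ¬ d ∣ n → h ⟨ + n ⟩ ≋ 0
    vanish n ih n≤N d∤n = ≋-cancelʳ-+ (v n n≤N d∤n) (≋-trans (≋-* (≋-refl {c}) (earlier (minus-view n a))) (≋-reflexive (*-zeroʳ c)))
      where
      earlier : ∀ {i} → MinusView n a i → h ⟨ i ⟩ ≋ 0
      earlier (≥-view a≤n) = ih (∸-monoʳ-< 1≤a a≤n) (≤-trans (m∸n≤m n a) n≤N)
                                (λ d∣n-a → d∤n (subst (d ∣_) (m∸n+n≡m a≤n) (∣m∣n⇒∣m+n d∣n-a d∣a)))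
      earlier {i = -[1+ k ]} (<-view _) = ≋-reflexive (negative-coeff≡0 h k)

  ∏-vanishes⁻¹ : ∀ {d N} e → (∀ i → d ∣ e i) → (∀ i → 1 ≤ e i) → ∀ K h →
                 VanishesOffMultiplesOf d N (×∏[1-q^ e < K ] h) → VanishesOffMultiplesOf d N h
  ∏-vanishes⁻¹ e d∣e 1≤e zero h v = v
  ∏-vanishes⁻¹ e d∣e 1≤e (suc K) h v = ∏-vanishes⁻¹ e d∣e 1≤e K h (×-vanishes⁻¹ (e K) (×∏[1-q^ e < K ] h) (d∣e K) (1≤e K) v)

-- 2-regular partitions and Euler's identity

sum-applyUpTo : ∀ L (f h : ℕ → ℕ) → sum (map h (applyUpTo f L)) ≡ Σ< L (λ i → h (f i))
sum-applyUpTo zero f h = refl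
sum-applyUpTo (suc L) f h = cong (_+_ (h (f 0))) (sum-applyUpTo L (λ i → f (suc i)) h)

sum-upTo : ∀ L h → sum (map h (upTo L)) ≡ Σ< L h
sum-upTo L h = sum-applyUpTo L (λ i → i) h

Σ<-last : ∀ L h → Σ< (suc L) h ≡ Σ< L h + h L
Σ<-last zero h = +-comm (h 0) 0
Σ<-last (suc L) h rewrite Σ<-last L (λ i → h (suc i)) = sym (+-assoc (h 0) _ _)

if-≤-yes : ∀ {x y} (u v : ℕ) → x ≤ y → (if ⌊ x ≤? y ⌋ then u else v) ≡ u
if-≤-yes {x} {y} u v x≤y with x ≤? y
... | yes _ = refl
... | no x≰y = contradiction x≤y x≰y

if-≤-no : ∀ {x y} (u v : ℕ) → ¬ x ≤ y → (if ⌊ x ≤? y ⌋ then u else v) ≡ v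
if-≤-no {x} {y} u v x≰y with x ≤? y
... | yes x≤y = contradiction x≤y x≰y
... | no _ = refl

odd : ℕ → ℕ
odd i = 2 * i + 1

1≤odd : ∀ i → 1 ≤ odd i
1≤odd i = m≤n+m 1 (2 * i)

oddCount-term : ℕ → ℕ → ℕ → ℕ
oddCount-term m r t = if ⌊ t * odd m ≤? r ⌋ then oddCount m (r ∸ t * odd m) else 0

oddCount-suc : ∀ m r → oddCount (suc m) r ≡ Σ< (suc r) (oddCount-term m r)
oddCount-suc m r = sum-upTo (suc r) (oddCount-term m r)

oddCount-term-> : ∀ m r t → r < t → oddCount-term m r t ≡ 0
oddCount-term-> m r t r<t = if-≤-no _ 0 λ t*a≤r → <⇒≱ r<t (≤-trans (m≤m*n t (odd m)) t*a≤r)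
  where
  instance
    odd≢0 : NonZero (odd m)
    odd≢0 = subst NonZero (+-comm 1 (2 * m)) _

oddCount-term-suc-< : ∀ m r t → r < odd m → oddCount-term m r (suc t) ≡ 0
oddCount-term-suc-< m r t r<a = if-≤-no _ 0 λ a+t*a≤r → <⇒≱ r<a (≤-trans (m≤m+n (odd m) (t * odd m)) a+t*a≤r)

oddCount-term-suc-≥ : ∀ m r t → odd m ≤ r → oddCount-term m r (suc t) ≡ oddCount-term m (r ∸ odd m) t
oddCount-term-suc-≥ m r t a≤r with t * odd m ≤? r ∸ odd m
... | yes t*a≤r-a = trans (if-≤-yes _ 0 (subst (_≤ r) (+-comm (t * odd m) (odd m)) (m≤o∸n⇒m+n≤o (t * odd m) a≤r t*a≤r-a)))
                          (cong (oddCount m) (sym (∸-+-assoc r (odd m) (t * odd m))))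
... | no t*a≰r-a = if-≤-no _ 0 (λ a+t*a≤r → t*a≰r-a (m+n≤o⇒m≤o∸n (t * odd m) (subst (_≤ r) (+-comm (odd m) (t * odd m)) a+t*a≤r)))

Σ<-oddCount-term-beyond : ∀ m r j → Σ< (j + suc r) (oddCount-term m r) ≡ Σ< (suc r) (oddCount-term m r)
Σ<-oddCount-term-beyond m r zero = refl
Σ<-oddCount-term-beyond m r (suc j) = begin
  Σ< (suc j + suc r) (oddCount-term m r)                                     ≡⟨ Σ<-last (j + suc r) _ ⟩
  Σ< (j + suc r) (oddCount-term m r) + oddCount-term m r (j + suc r)         ≡⟨ cong (_+_ _) (oddCount-term-> m r (j + suc r) (m≤n+m (suc r) j)) ⟩
  Σ< (j + suc r) (oddCount-term m r) + 0                                     ≡⟨ +-identityʳ _ ⟩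
  Σ< (j + suc r) (oddCount-term m r)                                         ≡⟨ Σ<-oddCount-term-beyond m r j ⟩
  Σ< (suc r) (oddCount-term m r)                                             ∎
  where open ≡-Reasoning

oddCount-suc-≥ : ∀ m r → odd m ≤ r → oddCount (suc m) r ≡ oddCount m r + oddCount (suc m) (r ∸ odd m)
oddCount-suc-≥ m r a≤r = begin
  oddCount (suc m) r                                                ≡⟨ oddCount-suc m r ⟩
  oddCount m r + Σ< r (λ t → oddCount-term m r (suc t))             ≡⟨ cong (_+_ _) (Σ<-cong r (λ t _ → oddCount-term-suc-≥ m r t a≤r)) ⟩
  oddCount m r + Σ< r (oddCount-term m (r ∸ odd m))                 ≡⟨ cong (λ L → oddCount m r + Σ< L (oddCount-term m (r ∸ odd m))) r≡ ⟨
  oddCount m r + Σ< (2 * m + suc (r ∸ odd m)) (oddCount-term m (r ∸ odd m))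
                                                                    ≡⟨ cong (_+_ _) (Σ<-oddCount-term-beyond m (r ∸ odd m) (2 * m)) ⟩
  oddCount m r + Σ< (suc (r ∸ odd m)) (oddCount-term m (r ∸ odd m)) ≡⟨ cong (_+_ (oddCount m r)) (oddCount-suc m (r ∸ odd m)) ⟨
  oddCount m r + oddCount (suc m) (r ∸ odd m)                       ∎
  where
  open ≡-Reasoning
  r≡ : 2 * m + suc (r ∸ odd m) ≡ r
  r≡ = trans (+-suc (2 * m) (r ∸ odd m)) (trans (+-comm (suc (2 * m)) (r ∸ odd m))
         (trans (cong (_+_ (r ∸ odd m)) (+-comm 1 (2 * m))) (m∸n+n≡m a≤r)))

oddCount-suc-< : ∀ m r → r < odd m → oddCount (suc m) r ≡ oddCount m r
oddCount-suc-< m r r<a = trans (oddCount-suc m r)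
  (trans (cong (_+_ (oddCount m r)) (Σ<-zero r _ (λ t _ → oddCount-term-suc-< m r t r<a))) (+-identityʳ _))

oddCount-stable : ∀ j n → oddCount (j + n) n ≡ reg2 n
oddCount-stable zero n = refl
oddCount-stable (suc j) n = trans (oddCount-suc-< (j + n) n n<odd) (oddCount-stable j n)
  where
  n<odd : n < odd (j + n)
  n<odd = ≤-trans (s≤s (≤-trans (m≤n+m n j) (m≤m+n (j + n) _))) (≤-reflexive (+-comm 1 (2 * (j + n))))

ofℕ : (ℕ → ℕ) → Series
ofℕ a = series coeff (λ _ → refl)
  where
  coeff : ℤ → ℕ
  coeff (+ n) = a n
  coeff -[1+ _ ] = 0

T₂ regular : Series
T₂ = ofℕ T2
regular = ofℕ reg2

T₂≐regular³ : T₂ ≐ regular ⋆ (regular ⋆ regular)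
T₂≐regular³ = mk≐ at
  where
  at : ∀ n → T₂ ⟨ n ⟩ ≡ (regular ⋆ (regular ⋆ regular)) ⟨ n ⟩
  at (+ n) = trans (sum-upTo (suc n) _) (Σ<-cong (suc n) λ a _ →
    trans (sum-upTo (suc (n ∸ a)) (λ b → reg2 a * reg2 b * reg2 ((n ∸ a) ∸ b))) (trans (Σ<-cong (suc (n ∸ a)) (λ b _ → *-assoc (reg2 a) (reg2 b) (reg2 ((n ∸ a) ∸ b))))
      (Σ<-*ˡ (suc (n ∸ a)) (reg2 a) (λ b → reg2 b * reg2 ((n ∸ a) ∸ b)))))
  at -[1+ _ ] = refl

module Euler (c : ℕ) where
  open Mod c

  ×-oddPartitions : ∀ m {N} → ×[1-q^ odd m ] ofℕ (oddCount (suc m)) ≈[ N ] ofℕ (oddCount m)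
  ×-oddPartitions m = mk≈ λ n _ → at n (+ n ℤ.- + odd m) (minus-view n (odd m))
    where
    at : ∀ n i → MinusView n (odd m) i → oddCount (suc m) n + c * ofℕ (oddCount (suc m)) ⟨ i ⟩ ≋ oddCount m n
    at n _ (≥-view a≤n) rewrite oddCount-suc-≥ m n a≤n = x+y+cy≋x (oddCount m n) _
    at n _ (<-view n<a) = ≋-reflexive (trans (cong₂ _+_ (oddCount-suc-< m n n<a) (*-zeroʳ c)) (+-identityʳ _))

  ∏-oddPartitions : ∀ m {N} → ×∏[1-q^ odd < m ] ofℕ (oddCount m) ≈[ N ] 𝟙
  ∏-oddPartitions zero = ≐⇒≈ (mk≐ λ { (+ zero) → refl ; (+ suc _) → refl ; -[1+ _ ] → refl })
  ∏-oddPartitions (suc m) {N} = begin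
    ×[1-q^ odd m ] ×∏[1-q^ odd < m ] ofℕ (oddCount (suc m))   ≈⟨ ≐⇒≈ (∏-natural odd ×[1-q^ odd m ]_ (×-cong (odd m)) (×-comm (odd m)) m _) ⟩
    ×∏[1-q^ odd < m ] ×[1-q^ odd m ] ofℕ (oddCount (suc m))   ≈⟨ ∏-resp-≈ odd m (×-oddPartitions m) ⟩
    ×∏[1-q^ odd < m ] ofℕ (oddCount m)                         ≈⟨ ∏-oddPartitions m ⟩
    𝟙                                                          ∎
    where open ≈-Reasoning (≈-setoid N)

  regular≈oddPartitions : ∀ {N M} → N ≤ M → regular ≈[ N ] ofℕ (oddCount M)
  regular≈oddPartitions {N} {M} N≤M = mk≈ λ n n≤N → ≋-reflexive (sym (begin
    oddCount M n               ≡⟨ cong (λ k → oddCount k n) (m∸n+n≡m (≤-trans n≤N N≤M)) ⟨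
    oddCount (M ∸ n + n) n     ≡⟨ oddCount-stable (M ∸ n) n ⟩
    reg2 n                     ∎))
    where open ≡-Reasoning

  ∏-regular : ∀ {N M} → N ≤ M → ×∏[1-q^ odd < M ] regular ≈[ N ] 𝟙
  ∏-regular N≤M = ≈-trans (∏-resp-≈ odd _ (regular≈oddPartitions N≤M)) (∏-oddPartitions _)

  ∏-regular-⋆ : ∀ {N M} → N ≤ M → ∀ g → ×∏[1-q^ odd < M ] (regular ⋆ g) ≈[ N ] g
  ∏-regular-⋆ {N} {M} N≤M g = begin
    ×∏[1-q^ odd < M ] (regular ⋆ g)   ≈⟨ ≐⇒≈ (∏-natural odd (_⋆ g) (⋆-congˡ g) (λ a f → ×-⋆ a f g) M regular) ⟨
    (×∏[1-q^ odd < M ] regular) ⋆ g   ≈⟨ ⋆-resp-≈ˡ g (∏-regular N≤M) ⟩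
    𝟙 ⋆ g                             ≈⟨ ≐⇒≈ (𝟙-⋆ g) ⟩
    g                                 ∎
    where open ≈-Reasoning (≈-setoid N)

  ∏³-T₂ : ∀ {N M} → N ≤ M → fold T₂ ×∏[1-q^ odd < M ]_ 3 ≈[ N ] 𝟙
  ∏³-T₂ {N} {M} N≤M = begin
    P (P (P T₂))                                ≈⟨ ∏-resp-≈ odd M (∏-resp-≈ odd M (≐⇒≈ (∏-cong odd M T₂≐regular³))) ⟩
    P (P (P (regular ⋆ (regular ⋆ regular))))   ≈⟨ ∏-resp-≈ odd M (∏-resp-≈ odd M (∏-regular-⋆ N≤M _)) ⟩
    P (P (regular ⋆ regular))                   ≈⟨ ∏-resp-≈ odd M (∏-regular-⋆ N≤M regular) ⟩
    P regular                                   ≈⟨ ∏-regular N≤M ⟩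
    𝟙                                           ∎
    where
    open ≈-Reasoning (≈-setoid N)
    P : Series → Series
    P = ×∏[1-q^ odd < M ]_

-- T₂ modulo 3

ℤ-minus-3× : ∀ n a → n ℤ.- + a ℤ.- + a ℤ.- + a ≡ n ℤ.- + (3 * a)
ℤ-minus-3× n a = lemma n (+ a)
  where
  open ℤSolver.+-*-Solver
  lemma : ∀ n x → n ℤ.- x ℤ.- x ℤ.- x ≡ n ℤ.- (x ℤ.+ (x ℤ.+ (x ℤ.+ + 0)))
  lemma = solve 2 (λ n x → n :- x :- x :- x := n :- (x :+ (x :+ (x :+ con (+ 0))))) refl

ℤ-minus-2× : ∀ n a → n ℤ.- + a ℤ.- + a ≡ n ℤ.- + (2 * a)
ℤ-minus-2× n a = lemma n (+ a)
  where
  open ℤSolver.+-*-Solver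
  lemma : ∀ n x → n ℤ.- x ℤ.- x ≡ n ℤ.- (x ℤ.+ (x ℤ.+ + 0))
  lemma = solve 2 (λ n x → n :- x :- x := n :- (x :+ (x :+ con (+ 0)))) refl

module Mod3 where
  open Mod 2

  ×³≈×[3a] : ∀ a f {N} → fold f ×[1-q^ a ]_ 3 ≈[ N ] ×[1-q^ 3 * a ] f
  ×³≈×[3a] a f = mk≈ λ n _ → at n
    where
    at : ∀ n → fold f ×[1-q^ a ]_ 3 ⟨ + n ⟩ ≋ (×[1-q^ 3 * a ] f) ⟨ + n ⟩
    at n = begin
      x0 + 2 * x1 + 2 * (x1 + 2 * x2) + 2 * (x1 + 2 * x2 + 2 * (x2 + 2 * x3))
                                                        ≡⟨ expand x0 x1 x2 x3 ⟩
      x0 + 2 * x3 + (2 * x1 + 4 * x2 + 2 * x3) * 3      ≈⟨ x+y*modulus≋x (x0 + 2 * x3) (2 * x1 + 4 * x2 + 2 * x3) ⟩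
      x0 + 2 * x3                                       ≡⟨ cong (λ i → x0 + 2 * f ⟨ i ⟩) (ℤ-minus-3× (+ n) a) ⟩
      (×[1-q^ 3 * a ] f) ⟨ + n ⟩                          ∎
      where
      open ≈-Reasoning ≋-setoid
      x0 = f ⟨ + n ⟩
      x1 = f ⟨ + n ℤ.- + a ⟩
      x2 = f ⟨ + n ℤ.- + a ℤ.- + a ⟩
      x3 = f ⟨ + n ℤ.- + a ℤ.- + a ℤ.- + a ⟩
      expand : ∀ x0 x1 x2 x3 → x0 + 2 * x1 + 2 * (x1 + 2 * x2) + 2 * (x1 + 2 * x2 + 2 * (x2 + 2 * x3))
                               ≡ x0 + 2 * x3 + (2 * x1 + 4 * x2 + 2 * x3) * 3
      expand = solve 4 (λ x0 x1 x2 x3 → x0 :+ con 2 :* x1 :+ con 2 :* (x1 :+ con 2 :* x2) :+ con 2 :* (x1 :+ con 2 :* x2 :+ con 2 :* (x2 :+ con 2 :* x3))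
                                       := x0 :+ con 2 :* x3 :+ (con 2 :* x1 :+ con 4 :* x2 :+ con 2 :* x3) :* con 3) refl
        where open +-*-Solver

  T2-mod3 : ∀ N → ¬ 3 ∣ N → 3 ∣ T2 N
  T2-mod3 N 8N+1≡[3A]²B⇒3∤N = m%n≡0⇒n∣m (T2 N) 3 (%-≡ (T₂-vanishes N ≤-refl 8N+1≡[3A]²B⇒3∤N))
    where
    open Euler 2
    ∏[1-q^3odd]-T₂ : ×∏[1-q^ (λ i → 3 * odd i) < N ] T₂ ≈[ N ] 𝟙
    ∏[1-q^3odd]-T₂ = ≈-trans (≈-sym (∏-frobenius 3 ×³≈×[3a] odd N T₂)) (∏³-T₂ ≤-refl)
    T₂-vanishes : VanishesOffMultiplesOf 3 N T₂
    T₂-vanishes = ∏-vanishes⁻¹ (λ i → 3 * odd i) (λ i → m∣m*n (odd i)) (λ i → ≤-trans (1≤odd i) (m≤n*m (odd i) 3)) N T₂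
                    (vanishes-resp-≈ ∏[1-q^3odd]-T₂ (𝟙-vanishes-off-multiples 3 N))

-- The finite Jacobi triple product

-- Formal Laurent series in z and q: f k n is the coefficient of z^k q^n.
Series₂ : Set
Series₂ = ℤ → ℤ → ℕ

infix 4 _≐₂_
record _≐₂_ (f g : Series₂) : Set where
  constructor mk≐₂
  field ≐₂-at : ∀ k n → f k n ≡ g k n
open _≐₂_ public

≐₂-setoid : Setoid 0ℓ 0ℓ
≐₂-setoid = record
  { Carrier = Series₂ ; _≈_ = _≐₂_
  ; isEquivalence = record
    { refl = mk≐₂ λ _ _ → refl
    ; sym = λ (mk≐₂ e) → mk≐₂ λ k n → sym (e k n)
    ; trans = λ (mk≐₂ e) (mk≐₂ e') → mk≐₂ λ k n → trans (e k n) (e' k n) } }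

open Setoid ≐₂-setoid public using () renaming (refl to ≐₂-refl; sym to ≐₂-sym; trans to ≐₂-trans)

δ₂ : Series₂
δ₂ (+ zero) (+ zero) = 1
δ₂ _ _ = 0

×[1+z^_q^_]_ : ℤ → ℤ → Series₂ → Series₂
(×[1+z^ s q^ a ] f) k n = f k n + f (k ℤ.- s) (n ℤ.- a)

×₂-cong : ∀ s a {f g} → f ≐₂ g → ×[1+z^ s q^ a ] f ≐₂ ×[1+z^ s q^ a ] g
×₂-cong s a (mk≐₂ e) = mk≐₂ λ k n → cong₂ _+_ (e k n) (e (k ℤ.- s) (n ℤ.- a))

×₂-comm : ∀ s a t b f → ×[1+z^ s q^ a ] (×[1+z^ t q^ b ] f) ≐₂ ×[1+z^ t q^ b ] (×[1+z^ s q^ a ] f)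
×₂-comm s a t b f = mk≐₂ at
  where
  at : ∀ k n → (×[1+z^ s q^ a ] (×[1+z^ t q^ b ] f)) k n ≡ (×[1+z^ t q^ b ] (×[1+z^ s q^ a ] f)) k n
  at k n rewrite ℤ-minus-comm k s t | ℤ-minus-comm n a b =
    +-interchange (f k n) (f (k ℤ.- t) (n ℤ.- b)) (f (k ℤ.- s) (n ℤ.- a)) (f (k ℤ.- t ℤ.- s) (n ℤ.- b ℤ.- a))

×∏[1+z^_q^_<_]_ : ℤ → (ℕ → ℤ) → ℕ → Series₂ → Series₂
×∏[1+z^ s q^ e < zero ] f = f
×∏[1+z^ s q^ e < suc K ] f = ×[1+z^ s q^ e K ] (×∏[1+z^ s q^ e < K ] f)

module _ (s : ℤ) where

  ∏₂-cong : ∀ e K {f g} → f ≐₂ g → ×∏[1+z^ s q^ e < K ] f ≐₂ ×∏[1+z^ s q^ e < K ] g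
  ∏₂-cong e zero f≐g = f≐g
  ∏₂-cong e (suc K) f≐g = ×₂-cong s (e K) (∏₂-cong e K f≐g)

  ∏₂-cong-exponent : ∀ {e e'} → (∀ i → e i ≡ e' i) → ∀ K f → ×∏[1+z^ s q^ e < K ] f ≐₂ ×∏[1+z^ s q^ e' < K ] f
  ∏₂-cong-exponent e≗e' zero f = ≐₂-refl
  ∏₂-cong-exponent {e} {e'} e≗e' (suc K) f rewrite e≗e' K = ×₂-cong s (e' K) (∏₂-cong-exponent e≗e' K f)

  ∏₂-× : ∀ e K t b f → ×∏[1+z^ s q^ e < K ] (×[1+z^ t q^ b ] f) ≐₂ ×[1+z^ t q^ b ] (×∏[1+z^ s q^ e < K ] f)
  ∏₂-× e zero t b f = ≐₂-refl
  ∏₂-× e (suc K) t b f = ≐₂-trans (×₂-cong s (e K) (∏₂-× e K t b f)) (×₂-comm s (e K) t b (×∏[1+z^ s q^ e < K ] f))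

  ∏₂-suc : ∀ e K f → ×∏[1+z^ s q^ e < suc K ] f ≐₂ ×[1+z^ s q^ e 0 ] (×∏[1+z^ s q^ (λ i → e (suc i)) < K ] f)
  ∏₂-suc e zero f = ≐₂-refl
  ∏₂-suc e (suc K) f = ≐₂-trans (×₂-cong s (e (suc K)) (∏₂-suc e K f))
                                (×₂-comm s (e (suc K)) s (e 0) (×∏[1+z^ s q^ (λ i → e (suc i)) < K ] f))

-- Substitution z ↦ z q⁴.
σ : Series₂ → Series₂
σ f k n = f k (n ℤ.- + 4 ℤ.* k)

σ-× : ∀ s a f → σ (×[1+z^ s q^ a ] f) ≐₂ ×[1+z^ s q^ a ℤ.+ + 4 ℤ.* s ] (σ f)
σ-× s a f = mk≐₂ λ k n → cong (λ i → f k (n ℤ.- + 4 ℤ.* k) + f (k ℤ.- s) i) (lemma n k s a)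
  where
  open ℤSolver.+-*-Solver
  lemma : ∀ n k s a → n ℤ.- + 4 ℤ.* k ℤ.- a ≡ n ℤ.- (a ℤ.+ + 4 ℤ.* s) ℤ.- + 4 ℤ.* (k ℤ.- s)
  lemma = solve 4 (λ n k s a → n :- con (+ 4) :* k :- a := n :- (a :+ con (+ 4) :* s) :- con (+ 4) :* (k :- s)) refl

σ-∏ : ∀ s e K f → σ (×∏[1+z^ s q^ e < K ] f) ≐₂ ×∏[1+z^ s q^ (λ i → e i ℤ.+ + 4 ℤ.* s) < K ] (σ f)
σ-∏ s e zero f = ≐₂-refl
σ-∏ s e (suc K) f = ≐₂-trans (σ-× s (e K) (×∏[1+z^ s q^ e < K ] f)) (×₂-cong s _ (σ-∏ s e K f))

σ-δ₂ : σ δ₂ ≐₂ δ₂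
σ-δ₂ = mk≐₂ at
  where
  at : ∀ k n → σ δ₂ k n ≡ δ₂ k n
  at (+ zero) n = cong (δ₂ (+ 0)) (ℤP.+-identityʳ n)
  at (+ suc _) n = refl
  at -[1+ _ ] n = refl

÷zq : Series₂ → Series₂
÷zq f k n = f (k ℤ.+ 1ℤ) (n ℤ.+ 1ℤ)

×[1+z⁻¹q⁻¹]≐÷zq×[1+zq] : ∀ f → ×[1+z^ -1ℤ q^ -1ℤ ] f ≐₂ ×[1+z^ 1ℤ q^ 1ℤ ] (÷zq f)
×[1+z⁻¹q⁻¹]≐÷zq×[1+zq] f = mk≐₂ λ k n →
  trans (+-comm (f k n) _) (cong₂ _+_ (cong₂ f (minus-neg k) (minus-neg n)) (cong₂ f (plus-minus k) (plus-minus n)))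
  where
  open ℤSolver.+-*-Solver
  minus-neg : ∀ x → x ℤ.- ℤ.- + 1 ≡ x ℤ.+ + 1
  minus-neg = solve 1 (λ x → x :- (:- con (+ 1)) := x :+ con (+ 1)) refl
  plus-minus : ∀ x → x ≡ x ℤ.- + 1 ℤ.+ + 1
  plus-minus = solve 1 (λ x → x := x :- con (+ 1) :+ con (+ 1)) refl

4i+1 4i+3 4i-1 : ℕ → ℤ
4i+1 i = + (4 * i + 1)
4i+3 i = + (4 * i + 3)
4i-1 i = + (4 * i) ℤ.- 1ℤ

JTP : ℕ → Series₂
JTP M = ×∏[1+z^ 1ℤ q^ 4i+1 < M ] ×∏[1+z^ -1ℤ q^ 4i+3 < M ] δ₂

JTP-suc : ∀ M → JTP (suc M) ≐₂ ×[1+z^ 1ℤ q^ 4i+1 M ] ×[1+z^ -1ℤ q^ 4i+3 M ] JTP M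
JTP-suc M = ×₂-cong 1ℤ (4i+1 M) (∏₂-× 1ℤ 4i+1 M -1ℤ (4i+3 M) _)

JTP-suc-vanishes : ∀ M k n → JTP M k n ≡ 0 → JTP M (k ℤ.- -1ℤ) (n ℤ.- 4i+3 M) ≡ 0 →
                   JTP M (k ℤ.- 1ℤ) (n ℤ.- 4i+1 M) ≡ 0 → JTP M (k ℤ.- 1ℤ ℤ.- -1ℤ) (n ℤ.- 4i+1 M ℤ.- 4i+3 M) ≡ 0 →
                   JTP (suc M) k n ≡ 0
JTP-suc-vanishes M k n z₀ z₁ z₂ z₃ = trans (≐₂-at (JTP-suc M) k n) (cong₂ _+_ (cong₂ _+_ z₀ z₁) (cong₂ _+_ z₂ z₃))

-[1+k]-1≡-[1+suc-k] : ∀ k → -[1+ k ] ℤ.- 1ℤ ≡ -[1+ suc k ]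
-[1+k]-1≡-[1+suc-k] k = trans (-[1+k]-a≡-[1+k+a] k 1) (cong -[1+_] (+-comm k 1))

+n+1≡+suc-n : ∀ n → + n ℤ.- -1ℤ ≡ + suc n
+n+1≡+suc-n n = cong +_ (+-comm n 1)

k-1+1≡k : ∀ k → k ℤ.- 1ℤ ℤ.- -1ℤ ≡ k
k-1+1≡k = solve 1 (λ k → k :- con 1ℤ :- con -1ℤ := k) refl
  where open ℤSolver.+-*-Solver

JTP-vanishes-below : ∀ M i n → JTP M -[1+ (i + M) ] n ≡ 0
JTP-vanishes-below zero i n = refl
JTP-vanishes-below (suc M) i n rewrite +-suc i M = JTP-suc-vanishes M _ n
  (JTP-vanishes-below M (suc i) n)
  (JTP-vanishes-below M i _)
  (trans (cong (λ k → JTP M k (n ℤ.- 4i+1 M)) (-[1+k]-1≡-[1+suc-k] (suc (i + M)))) (JTP-vanishes-below M (suc (suc i)) _))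
  (trans (cong (λ k → JTP M k (n ℤ.- 4i+1 M ℤ.- 4i+3 M)) (k-1+1≡k _)) (JTP-vanishes-below M (suc i) _))

JTP-vanishes-above : ∀ M i n → JTP M (+ suc (i + M)) n ≡ 0
JTP-vanishes-above zero i n = refl
JTP-vanishes-above (suc M) i n rewrite +-suc i M = JTP-suc-vanishes M _ n
  (JTP-vanishes-above M (suc i) n)
  (trans (cong (λ k → JTP M k (n ℤ.- 4i+3 M)) (+n+1≡+suc-n (suc (suc (i + M))))) (JTP-vanishes-above M (suc (suc i)) _))
  (JTP-vanishes-above M i _)
  (trans (cong (λ k → JTP M k (n ℤ.- 4i+1 M ℤ.- 4i+3 M)) (k-1+1≡k _)) (JTP-vanishes-above M (suc i) _))

JTP-vanishes-negative : ∀ M k x → JTP M k -[1+ x ] ≡ 0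
JTP-vanishes-negative zero (+ zero) x = refl
JTP-vanishes-negative zero (+ suc _) x = refl
JTP-vanishes-negative zero -[1+ _ ] x = refl
JTP-vanishes-negative (suc M) k x = JTP-suc-vanishes M k _
  (JTP-vanishes-negative M k x)
  (trans (cong (JTP M _) (-[1+k]-a≡-[1+k+a] x (4 * M + 3))) (JTP-vanishes-negative M _ _))
  (trans (cong (JTP M _) (-[1+k]-a≡-[1+k+a] x (4 * M + 1))) (JTP-vanishes-negative M _ _))
  (trans (cong (JTP M _) (trans (cong (ℤ._- 4i+3 M) (-[1+k]-a≡-[1+k+a] x (4 * M + 1)))
                                (-[1+k]-a≡-[1+k+a] (x + (4 * M + 1)) (4 * M + 3))))
         (JTP-vanishes-negative M _ _))

σ-JTP : ∀ M → σ (JTP M) ≐₂ ×∏[1+z^ 1ℤ q^ (λ i → 4i+1 (suc i)) < M ] ×∏[1+z^ -1ℤ q^ 4i-1 < M ] δ₂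
σ-JTP M = begin
  σ (JTP M)
    ≈⟨ σ-∏ 1ℤ 4i+1 M _ ⟩
  ×∏[1+z^ 1ℤ q^ (λ i → 4i+1 i ℤ.+ + 4 ℤ.* 1ℤ) < M ] σ (×∏[1+z^ -1ℤ q^ 4i+3 < M ] δ₂)
    ≈⟨ ∏₂-cong-exponent 1ℤ (λ i → cong +_ (4i+1+4 i)) M _ ⟩
  ×∏[1+z^ 1ℤ q^ (λ i → 4i+1 (suc i)) < M ] σ (×∏[1+z^ -1ℤ q^ 4i+3 < M ] δ₂)
    ≈⟨ ∏₂-cong 1ℤ _ M (σ-∏ -1ℤ 4i+3 M δ₂) ⟩
  ×∏[1+z^ 1ℤ q^ (λ i → 4i+1 (suc i)) < M ] ×∏[1+z^ -1ℤ q^ (λ i → 4i+3 i ℤ.+ + 4 ℤ.* -1ℤ) < M ] σ δ₂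
    ≈⟨ ∏₂-cong 1ℤ _ M (≐₂-trans (∏₂-cong-exponent -1ℤ (λ i → 4i+3-4 (+ (4 * i))) M _) (∏₂-cong -1ℤ 4i-1 M σ-δ₂)) ⟩
  ×∏[1+z^ 1ℤ q^ (λ i → 4i+1 (suc i)) < M ] ×∏[1+z^ -1ℤ q^ 4i-1 < M ] δ₂ ∎
  where
  open ≈-Reasoning ≐₂-setoid
  4i+1+4 : ∀ i → 4 * i + 1 + 4 ≡ 4 * suc i + 1
  4i+1+4 = solve 1 (λ i → con 4 :* i :+ con 1 :+ con 4 := con 4 :* (con 1 :+ i) :+ con 1) refl
    where open +-*-Solver
  4i+3-4 : ∀ x → x ℤ.+ + 3 ℤ.+ + 4 ℤ.* -1ℤ ≡ x ℤ.- 1ℤ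
  4i+3-4 = solve 1 (λ x → x :+ con (+ 3) :+ con (+ 4) :* con -1ℤ := x :- con 1ℤ) refl
    where open ℤSolver.+-*-Solver

∏[1+z⁻¹q^4i-1]-suc : ∀ M → ×∏[1+z^ -1ℤ q^ 4i-1 < suc M ] δ₂ ≐₂ ×[1+z^ -1ℤ q^ -1ℤ ] ×∏[1+z^ -1ℤ q^ 4i+3 < M ] δ₂
∏[1+z⁻¹q^4i-1]-suc M = ≐₂-trans (∏₂-suc -1ℤ 4i-1 M δ₂) (×₂-cong -1ℤ -1ℤ (∏₂-cong-exponent -1ℤ 4[i+1]-1 M δ₂))
  where
  4+x-1 : ∀ x → + 4 ℤ.+ x ℤ.- 1ℤ ≡ x ℤ.+ + 3
  4+x-1 = solve 1 (λ x → con (+ 4) :+ x :- con 1ℤ := x :+ con (+ 3)) refl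
    where open ℤSolver.+-*-Solver
  4[i+1]-1 : ∀ i → 4i-1 (suc i) ≡ 4i+3 i
  4[i+1]-1 i = trans (cong (λ m → + m ℤ.- 1ℤ) (*-suc 4 i)) (4+x-1 (+ (4 * i)))

-- Both sides are ∏_{i≤M} (1 + z q^(4i+1)) (1 + z⁻¹ q^(4i-1)).
JTP-functional-identity : ∀ M →
  ×[1+z^ 1ℤ q^ 1ℤ ] ×[1+z^ -1ℤ q^ 4i-1 M ] σ (JTP M) ≐₂ ×[1+z^ 1ℤ q^ 1ℤ ] ×[1+z^ 1ℤ q^ 4i+1 M ] ÷zq (JTP M)
JTP-functional-identity M = begin
  ×[1+z^ 1ℤ q^ 1ℤ ] ×[1+z^ -1ℤ q^ 4i-1 M ] σ (JTP M)
    ≈⟨ ×₂-cong 1ℤ 1ℤ (×₂-cong -1ℤ (4i-1 M) (σ-JTP M)) ⟩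
  ×[1+z^ 1ℤ q^ 1ℤ ] ×[1+z^ -1ℤ q^ 4i-1 M ] ×∏[1+z^ 1ℤ q^ (λ i → 4i+1 (suc i)) < M ] ×∏[1+z^ -1ℤ q^ 4i-1 < M ] δ₂
    ≈⟨ ×₂-cong 1ℤ 1ℤ (∏₂-× 1ℤ (λ i → 4i+1 (suc i)) M -1ℤ (4i-1 M) _) ⟨
  ×[1+z^ 1ℤ q^ 1ℤ ] ×∏[1+z^ 1ℤ q^ (λ i → 4i+1 (suc i)) < M ] ×∏[1+z^ -1ℤ q^ 4i-1 < suc M ] δ₂
    ≈⟨ ∏₂-suc 1ℤ 4i+1 M _ ⟨
  ×∏[1+z^ 1ℤ q^ 4i+1 < suc M ] ×∏[1+z^ -1ℤ q^ 4i-1 < suc M ] δ₂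
    ≈⟨ ×₂-cong 1ℤ (4i+1 M) (∏₂-cong 1ℤ 4i+1 M (∏[1+z⁻¹q^4i-1]-suc M)) ⟩
  ×[1+z^ 1ℤ q^ 4i+1 M ] ×∏[1+z^ 1ℤ q^ 4i+1 < M ] ×[1+z^ -1ℤ q^ -1ℤ ] ×∏[1+z^ -1ℤ q^ 4i+3 < M ] δ₂
    ≈⟨ ×₂-cong 1ℤ (4i+1 M) (∏₂-× 1ℤ 4i+1 M -1ℤ -1ℤ _) ⟩
  ×[1+z^ 1ℤ q^ 4i+1 M ] ×[1+z^ -1ℤ q^ -1ℤ ] JTP M
    ≈⟨ ×₂-cong 1ℤ (4i+1 M) (×[1+z⁻¹q⁻¹]≐÷zq×[1+zq] (JTP M)) ⟩
  ×[1+z^ 1ℤ q^ 4i+1 M ] ×[1+z^ 1ℤ q^ 1ℤ ] ÷zq (JTP M)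
    ≈⟨ ×₂-comm 1ℤ (4i+1 M) 1ℤ 1ℤ (÷zq (JTP M)) ⟩
  ×[1+z^ 1ℤ q^ 1ℤ ] ×[1+z^ 1ℤ q^ 4i+1 M ] ÷zq (JTP M) ∎
  where open ≈-Reasoning ≐₂-setoid

k[2k-1] : ℤ → ℕ
k[2k-1] (+ zero) = 0
k[2k-1] (+ suc i) = suc i * suc (2 * i)
k[2k-1] -[1+ i ] = suc i * (2 * i + 3)

k[2k-1]-suc : ∀ i → k[2k-1] (+ suc i) ≡ k[2k-1] (+ i) + (4 * i + 1)
k[2k-1]-suc zero = refl
k[2k-1]-suc (suc i) = solve 1 (λ i → (con 2 :+ i) :* (con 1 :+ con 2 :* (con 1 :+ i))
                                 := (con 1 :+ i) :* (con 1 :+ con 2 :* i) :+ (con 4 :* (con 1 :+ i) :+ con 1)) refl i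
  where open +-*-Solver

k[2k-1]-neg-suc : ∀ i → k[2k-1] -[1+ suc i ] ≡ k[2k-1] -[1+ i ] + (4 * i + 7)
k[2k-1]-neg-suc i = solve 1 (λ i → (con 2 :+ i) :* (con 2 :* (con 1 :+ i) :+ con 3)
                                 := (con 1 :+ i) :* (con 2 :* i :+ con 3) :+ (con 4 :* i :+ con 7)) refl i
  where open +-*-Solver

above-or-below : ∀ L k → Σ ℕ (λ j → k ≡ -[1+ L ] ℤ.+ + j) ⊎ Σ ℕ (λ i → k ≡ -[1+ (i + L) ])
above-or-below L k with k ℤ.+ + suc L in eq
... | + j = inj₁ (j , trans (lemma k (+ L)) (cong (ℤ._+_ -[1+ L ]) eq))
  where
  open ℤSolver.+-*-Solver
  lemma : ∀ k l → k ≡ ℤ.- (+ 1 ℤ.+ l) ℤ.+ (k ℤ.+ (+ 1 ℤ.+ l))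
  lemma = solve 2 (λ k l → k := :- (con (+ 1) :+ l) :+ (k :+ (con (+ 1) :+ l))) refl
... | -[1+ i ] = inj₂ (suc i , trans (lemma k (+ suc L)) (trans (cong (ℤ._- + suc L) eq)
                                (trans (-[1+k]-a≡-[1+k+a] i (suc L)) (cong -[1+_] (+-suc i L)))))
  where
  open ℤSolver.+-*-Solver
  lemma : ∀ k l → k ≡ k ℤ.+ l ℤ.- l
  lemma = solve 2 (λ k l → k := k :+ l :- l) refl

module FunctionalEquation (c : ℕ) where
  open Mod c

  ×[1+zq^a]-cancel : ∀ a L (A B : Series₂) → (∀ i n → A -[1+ (i + L) ] n ≡ 0) → (∀ i n → B -[1+ (i + L) ] n ≡ 0) →
                     (∀ k n → (×[1+z^ 1ℤ q^ a ] A) k n ≋ (×[1+z^ 1ℤ q^ a ] B) k n) → ∀ k n → A k n ≋ B k n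
  ×[1+zq^a]-cancel a L A B A-vanishes B-vanishes ×A≋×B k n with above-or-below L k
  ... | inj₁ (j , refl) = from-bottom j n
    where
    open ℤSolver.+-*-Solver
    k+1-1≡k : ∀ k j → k ℤ.+ (+ 1 ℤ.+ j) ℤ.- 1ℤ ≡ k ℤ.+ j
    k+1-1≡k = solve 2 (λ k j → k :+ (con (+ 1) :+ j) :- con 1ℤ := k :+ j) refl
    from-bottom : ∀ j n → A (-[1+ L ] ℤ.+ + j) n ≋ B (-[1+ L ] ℤ.+ + j) n
    from-bottom zero n = ≋-reflexive (trans (A-vanishes 0 n) (sym (B-vanishes 0 n)))
    from-bottom (suc j) n = ≋-cancelʳ-+ (×A≋×B _ n)
      (subst (λ k → A k (n ℤ.- a) ≋ B k (n ℤ.- a)) (sym (k+1-1≡k -[1+ L ] (+ j))) (from-bottom j (n ℤ.- a)))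
  ... | inj₂ (i , refl) = ≋-reflexive (trans (A-vanishes i n) (sym (B-vanishes i n)))

  module _ (M : ℕ) where

    JTP-functional-equation : ∀ k n → (×[1+z^ -1ℤ q^ 4i-1 M ] σ (JTP M)) k n ≋ (×[1+z^ 1ℤ q^ 4i+1 M ] ÷zq (JTP M)) k n
    JTP-functional-equation = ×[1+zq^a]-cancel 1ℤ (suc M) _ _ σ-vanishes ÷zq-vanishes
                                (λ k n → ≋-reflexive (≐₂-at (JTP-functional-identity M) k n))
      where
      σ-vanishes : ∀ i n → (×[1+z^ -1ℤ q^ 4i-1 M ] σ (JTP M)) -[1+ (i + suc M) ] n ≡ 0
      σ-vanishes i n rewrite +-suc i M = cong₂ _+_ (JTP-vanishes-below M (suc i) _) (JTP-vanishes-below M i _)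
      ÷zq-vanishes : ∀ i n → (×[1+z^ 1ℤ q^ 4i+1 M ] ÷zq (JTP M)) -[1+ (i + suc M) ] n ≡ 0
      ÷zq-vanishes i n rewrite +-suc i M =
        cong₂ _+_ (JTP-vanishes-below M i _)
                  (trans (cong (λ k → JTP M k (n ℤ.- 4i+1 M ℤ.+ 1ℤ)) (k-1+1≡k _)) (JTP-vanishes-below M (suc i) _))

    -- Away from the boundary terms the functional equation says that the coefficient of z^(k+1) is
    -- q^(4k+1) times that of z^k.  A hypothesis x + suc d ≡ W encodes x < W for the ring solver.
    JTP-step : ∀ k x d₁ d₂ → x ℤ.+ + 4 ℤ.* k ℤ.+ + suc d₁ ≡ + (4 * M) → x ℤ.+ + suc d₂ ≡ + (4 * M) →
               JTP M k x ≋ JTP M (k ℤ.+ 1ℤ) (x ℤ.+ + 4 ℤ.* k ℤ.+ 1ℤ)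
    JTP-step k x d₁ d₂ h₁ h₂ = begin
      JTP M k x
        ≡⟨ cong (JTP M k) (n-4k≡x x k) ⟨
      JTP M k (n ℤ.- + 4 ℤ.* k)
        ≡⟨ +-identityʳ _ ⟨
      JTP M k (n ℤ.- + 4 ℤ.* k) + 0
        ≡⟨ cong (_+_ (JTP M k (n ℤ.- + 4 ℤ.* k))) σ-boundary ⟨
      (×[1+z^ -1ℤ q^ 4i-1 M ] σ (JTP M)) k n
        ≈⟨ JTP-functional-equation k n ⟩
      (×[1+z^ 1ℤ q^ 4i+1 M ] ÷zq (JTP M)) k n
        ≡⟨ cong (_+_ (JTP M (k ℤ.+ 1ℤ) (n ℤ.+ 1ℤ))) ÷zq-boundary ⟩
      JTP M (k ℤ.+ 1ℤ) (n ℤ.+ 1ℤ) + 0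
        ≡⟨ +-identityʳ _ ⟩
      JTP M (k ℤ.+ 1ℤ) (n ℤ.+ 1ℤ) ∎
      where
      open ≈-Reasoning ≋-setoid
      open ℤSolver.+-*-Solver
      n = x ℤ.+ + 4 ℤ.* k
      n-4k≡x : ∀ x k → x ℤ.+ + 4 ℤ.* k ℤ.- + 4 ℤ.* k ≡ x
      n-4k≡x = solve 2 (λ x k → x :+ con (+ 4) :* k :- con (+ 4) :* k := x) refl
      σ-index : ∀ x k D → x ℤ.+ + 4 ℤ.* k ℤ.- (x ℤ.+ (+ 1 ℤ.+ D) ℤ.- 1ℤ) ℤ.- + 4 ℤ.* (k ℤ.- -1ℤ) ≡ ℤ.- (+ 1 ℤ.+ (D ℤ.+ + 3))
      σ-index = solve 3 (λ x k D → x :+ con (+ 4) :* k :- (x :+ (con (+ 1) :+ D) :- con 1ℤ) :- con (+ 4) :* (k :- con -1ℤ)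
                                 := :- (con (+ 1) :+ (D :+ con (+ 3)))) refl
      σ-boundary : JTP M (k ℤ.- -1ℤ) (n ℤ.- 4i-1 M ℤ.- + 4 ℤ.* (k ℤ.- -1ℤ)) ≡ 0
      σ-boundary = trans (cong (JTP M (k ℤ.- -1ℤ)) (trans (cong (λ W → n ℤ.- (W ℤ.- 1ℤ) ℤ.- + 4 ℤ.* (k ℤ.- -1ℤ)) (sym h₂))
                                                          (σ-index x k (+ d₂))))
                         (JTP-vanishes-negative M _ (d₂ + 3))
      ÷zq-index : ∀ n D → n ℤ.- (n ℤ.+ (+ 1 ℤ.+ D) ℤ.+ + 1) ℤ.+ + 1 ≡ ℤ.- (+ 1 ℤ.+ D)
      ÷zq-index = solve 2 (λ n D → n :- (n :+ (con (+ 1) :+ D) :+ con (+ 1)) :+ con (+ 1) := :- (con (+ 1) :+ D)) refl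
      ÷zq-boundary : JTP M (k ℤ.- 1ℤ ℤ.+ 1ℤ) (n ℤ.- 4i+1 M ℤ.+ 1ℤ) ≡ 0
      ÷zq-boundary = trans (cong (JTP M (k ℤ.- 1ℤ ℤ.+ 1ℤ)) (trans (cong (λ W → n ℤ.- (W ℤ.+ + 1) ℤ.+ + 1) (sym h₁))
                                                                  (÷zq-index n (+ d₁))))
                           (JTP-vanishes-negative M _ d₁)

    JTP-step-neg : ∀ j m d → m ℤ.+ + suc d ≡ + (4 * M) →
                   JTP M -[1+ j ] m ≋ JTP M (-[1+ j ] ℤ.+ 1ℤ) (m ℤ.+ + 4 ℤ.* -[1+ j ] ℤ.+ 1ℤ)
    JTP-step-neg j m d h = JTP-step -[1+ j ] m (d + 4 * suc j) d h₁ h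
      where
      witness : ∀ m F D → m ℤ.- F ℤ.+ (+ 1 ℤ.+ D ℤ.+ F) ≡ m ℤ.+ (+ 1 ℤ.+ D)
      witness = solve 3 (λ m F D → m :- F :+ (con (+ 1) :+ D :+ F) := m :+ (con (+ 1) :+ D)) refl
        where open ℤSolver.+-*-Solver
      h₁ : m ℤ.+ + 4 ℤ.* -[1+ j ] ℤ.+ + suc (d + 4 * suc j) ≡ + (4 * M)
      h₁ = trans (cong (λ y → m ℤ.+ y ℤ.+ + suc (d + 4 * suc j)) (cong ℤ.-_ (sym (ℤP.pos-* 4 (suc j)))))
                 (trans (witness m (+ (4 * suc j)) (+ d)) h)

    JTP-reduce : ∀ k m d → m ℤ.+ + suc d ≡ + (4 * M) → JTP M k m ≋ JTP M 0ℤ (m ℤ.- + k[2k-1] k)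
    JTP-reduce (+ zero) m d h = ≋-reflexive (cong (JTP M 0ℤ) (sym (ℤP.+-identityʳ m)))
    JTP-reduce (+ suc i) m d h = begin
      JTP M (+ suc i) m                                 ≡⟨ cong₂ (JTP M) (cong +_ (+-comm i 1)) (x+4i+1≡m m F) ⟨
      JTP M (+ i ℤ.+ 1ℤ) (x ℤ.+ F ℤ.+ 1ℤ)               ≡⟨ cong (λ y → JTP M (+ i ℤ.+ 1ℤ) (x ℤ.+ y ℤ.+ 1ℤ)) F≡4*i ⟩
      JTP M (+ i ℤ.+ 1ℤ) (x ℤ.+ + 4 ℤ.* + i ℤ.+ 1ℤ)     ≈⟨ JTP-step (+ i) x (suc d) (suc d + 4 * i) h₁ h₂ ⟨
      JTP M (+ i) x                                     ≈⟨ JTP-reduce (+ i) x (suc d + 4 * i) h₂ ⟩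
      JTP M 0ℤ (x ℤ.- + k[2k-1] (+ i))                  ≡⟨ cong (JTP M 0ℤ) (trans (x-E≡m-[E+F+1] m F (+ k[2k-1] (+ i)))
                                                             (cong (λ e → m ℤ.- + e) (sym (k[2k-1]-suc i)))) ⟩
      JTP M 0ℤ (m ℤ.- + k[2k-1] (+ suc i))              ∎
      where
      open ≈-Reasoning ≋-setoid
      open ℤSolver.+-*-Solver
      F = + (4 * i)
      F≡4*i : F ≡ + 4 ℤ.* + i
      F≡4*i = ℤP.pos-* 4 i
      x = m ℤ.- 1ℤ ℤ.- F
      x+4i+1≡m : ∀ m F → m ℤ.- 1ℤ ℤ.- F ℤ.+ F ℤ.+ 1ℤ ≡ m
      x+4i+1≡m = solve 2 (λ m F → m :- con 1ℤ :- F :+ F :+ con 1ℤ := m) refl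
      x-E≡m-[E+F+1] : ∀ m F E → m ℤ.- 1ℤ ℤ.- F ℤ.- E ≡ m ℤ.- (E ℤ.+ (F ℤ.+ + 1))
      x-E≡m-[E+F+1] = solve 3 (λ m F E → m :- con 1ℤ :- F :- E := m :- (E :+ (F :+ con (+ 1)))) refl
      witness₁ : ∀ m F D → m ℤ.- 1ℤ ℤ.- F ℤ.+ F ℤ.+ (+ 1 ℤ.+ (+ 1 ℤ.+ D)) ≡ m ℤ.+ (+ 1 ℤ.+ D)
      witness₁ = solve 3 (λ m F D → m :- con 1ℤ :- F :+ F :+ (con (+ 1) :+ (con (+ 1) :+ D)) := m :+ (con (+ 1) :+ D)) refl
      h₁ : x ℤ.+ + 4 ℤ.* + i ℤ.+ + suc (suc d) ≡ + (4 * M)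
      h₁ = trans (cong (λ y → x ℤ.+ y ℤ.+ + suc (suc d)) (sym F≡4*i)) (trans (witness₁ m F (+ d)) h)
      witness₂ : ∀ m F D → m ℤ.- 1ℤ ℤ.- F ℤ.+ (+ 1 ℤ.+ (+ 1 ℤ.+ D ℤ.+ F)) ≡ m ℤ.+ (+ 1 ℤ.+ D)
      witness₂ = solve 3 (λ m F D → m :- con 1ℤ :- F :+ (con (+ 1) :+ (con (+ 1) :+ D :+ F)) := m :+ (con (+ 1) :+ D)) refl
      h₂ : x ℤ.+ + suc (suc d + 4 * i) ≡ + (4 * M)
      h₂ = trans (witness₂ m F (+ d)) h
    JTP-reduce -[1+ zero ] m d h = ≋-trans (JTP-step-neg zero m d h) (≋-reflexive (cong (JTP M 0ℤ) (m-4+1≡m-3 m)))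
      where
      m-4+1≡m-3 : ∀ m → m ℤ.+ + 4 ℤ.* -1ℤ ℤ.+ 1ℤ ≡ m ℤ.- + 3
      m-4+1≡m-3 = solve 1 (λ m → m :+ con (+ 4) :* con -1ℤ :+ con 1ℤ := m :- con (+ 3)) refl
        where open ℤSolver.+-*-Solver
    JTP-reduce -[1+ suc j ] m d h =
      ≋-trans (JTP-step-neg (suc j) m d h)
      (≋-trans (JTP-reduce -[1+ j ] m' (d + 4 * j + 7) (trans (witness m (+ j) (+ d)) h))
               (≋-reflexive (cong (JTP M 0ℤ) (trans (index m (+ j) (+ k[2k-1] -[1+ j ]))
                                                    (cong (λ e → m ℤ.- + e) (sym (k[2k-1]-neg-suc j)))))))
      where
      open ℤSolver.+-*-Solver
      m' = m ℤ.+ + 4 ℤ.* -[1+ suc j ] ℤ.+ 1ℤ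
      witness : ∀ m J D → m ℤ.+ + 4 ℤ.* ℤ.- (+ 1 ℤ.+ (+ 1 ℤ.+ J)) ℤ.+ 1ℤ ℤ.+ (+ 1 ℤ.+ (D ℤ.+ (J ℤ.+ (J ℤ.+ (J ℤ.+ (J ℤ.+ + 0)))) ℤ.+ + 7))
                        ≡ m ℤ.+ (+ 1 ℤ.+ D)
      witness = solve 3 (λ m J D → m :+ con (+ 4) :* (:- (con (+ 1) :+ (con (+ 1) :+ J))) :+ con 1ℤ
                                     :+ (con (+ 1) :+ (D :+ (J :+ (J :+ (J :+ (J :+ con (+ 0))))) :+ con (+ 7)))
                                   := m :+ (con (+ 1) :+ D)) refl
      index : ∀ m J E → m ℤ.+ + 4 ℤ.* ℤ.- (+ 1 ℤ.+ (+ 1 ℤ.+ J)) ℤ.+ 1ℤ ℤ.- E ≡ m ℤ.- (E ℤ.+ ((J ℤ.+ (J ℤ.+ (J ℤ.+ (J ℤ.+ + 0)))) ℤ.+ + 7))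
      index = solve 3 (λ m J E → m :+ con (+ 4) :* (:- (con (+ 1) :+ (con (+ 1) :+ J))) :+ con 1ℤ :- E
                                 := m :- (E :+ ((J :+ (J :+ (J :+ (J :+ con (+ 0))))) :+ con (+ 7)))) refl

Σ± : ℕ → (ℤ → ℕ) → ℕ
Σ± zero g = g 0ℤ
Σ± (suc L) g = Σ± L g + (g (+ suc L) + g -[1+ L ])

Σ±-cong : ∀ L {g g'} → (∀ k → g k ≡ g' k) → Σ± L g ≡ Σ± L g'
Σ±-cong zero e = e 0ℤ
Σ±-cong (suc L) e = cong₂ _+_ (Σ±-cong L e) (cong₂ _+_ (e _) (e _))

Σ±-+ : ∀ L g h → Σ± L (λ k → g k + h k) ≡ Σ± L g + Σ± L h
Σ±-+ zero g h = refl
Σ±-+ (suc L) g h rewrite Σ±-+ L g h = rearrange (Σ± L g) (Σ± L h) (g (+ suc L)) (h (+ suc L)) (g -[1+ L ]) (h -[1+ L ])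
  where
  rearrange : ∀ a b c d e f → a + b + (c + d + (e + f)) ≡ a + (c + e) + (b + (d + f))
  rearrange = solve 6 (λ a b c d e f → a :+ b :+ (c :+ d :+ (e :+ f)) := a :+ (c :+ e) :+ (b :+ (d :+ f))) refl
    where open +-*-Solver

Σ±-*ˡ : ∀ L x g → Σ± L (λ k → x * g k) ≡ x * Σ± L g
Σ±-*ˡ zero x g = refl
Σ±-*ˡ (suc L) x g rewrite Σ±-*ˡ L x g =
  sym (trans (*-distribˡ-+ x (Σ± L g) _) (cong (_+_ (x * Σ± L g)) (*-distribˡ-+ x (g (+ suc L)) _)))

Σ±-zero : ∀ L g → (∀ k → g k ≡ 0) → Σ± L g ≡ 0
Σ±-zero zero g e = e 0ℤ
Σ±-zero (suc L) g e = cong₂ _+_ (Σ±-zero L g e) (cong₂ _+_ (e _) (e _))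

Σ±-suc-vanishing : ∀ L g → g (+ suc L) ≡ 0 → g -[1+ L ] ≡ 0 → Σ± (suc L) g ≡ Σ± L g
Σ±-suc-vanishing L g g₊≡0 g₋≡0 rewrite g₊≡0 | g₋≡0 = +-identityʳ _

Σ±-shift-down : ∀ L g → Σ± L (λ k → g (k ℤ.- 1ℤ)) + g (+ L) ≡ Σ± L g + g -[1+ L ]
Σ±-shift-down zero g = +-comm (g -1ℤ) (g 0ℤ)
Σ±-shift-down (suc L) g = begin
  Σ± L g⁻ + (g (+ L) + g (-[1+ L ] ℤ.- 1ℤ)) + g (+ suc L)   ≡⟨ cong (λ k → Σ± L g⁻ + (g (+ L) + g k) + g (+ suc L)) (-[1+k]-1≡-[1+suc-k] L) ⟩
  Σ± L g⁻ + (g (+ L) + g -[1+ suc L ]) + g (+ suc L)        ≡⟨ regroup (Σ± L g⁻) (g (+ L)) _ _ ⟩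
  Σ± L g⁻ + g (+ L) + g -[1+ suc L ] + g (+ suc L)          ≡⟨ cong (λ x → x + g -[1+ suc L ] + g (+ suc L)) (Σ±-shift-down L g) ⟩
  Σ± L g + g -[1+ L ] + g -[1+ suc L ] + g (+ suc L)        ≡⟨ regroup′ (Σ± L g) (g -[1+ L ]) _ _ ⟩
  Σ± L g + (g (+ suc L) + g -[1+ L ]) + g -[1+ suc L ]      ∎
  where
  open ≡-Reasoning
  g⁻ = λ k → g (k ℤ.- 1ℤ)
  regroup : ∀ a b c d → a + (b + c) + d ≡ a + b + c + d
  regroup = solve 4 (λ a b c d → a :+ (b :+ c) :+ d := a :+ b :+ c :+ d) refl
    where open +-*-Solver
  regroup′ : ∀ a b c d → a + b + c + d ≡ a + (d + b) + c
  regroup′ = solve 4 (λ a b c d → a :+ b :+ c :+ d := a :+ (d :+ b) :+ c) refl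
    where open +-*-Solver

Σ±-shift-up : ∀ L g → Σ± L (λ k → g (k ℤ.+ 1ℤ)) + g (ℤ.- + L) ≡ Σ± L g + g (+ suc L)
Σ±-shift-up zero g = +-comm (g 1ℤ) (g 0ℤ)
Σ±-shift-up (suc L) g = begin
  Σ± L g⁺ + (g (+ suc L ℤ.+ 1ℤ) + g (-[1+ L ] ℤ.+ 1ℤ)) + g -[1+ L ]   ≡⟨ cong₂ (λ x y → Σ± L g⁺ + (g x + g y) + g -[1+ L ]) (cong +_ (+-comm (suc L) 1)) (-[1+L]+1 L) ⟩
  Σ± L g⁺ + (g (+ suc (suc L)) + g (ℤ.- + L)) + g -[1+ L ]             ≡⟨ regroup (Σ± L g⁺) (g (+ suc (suc L))) _ _ ⟩
  Σ± L g⁺ + g (ℤ.- + L) + g (+ suc (suc L)) + g -[1+ L ]               ≡⟨ cong (λ x → x + g (+ suc (suc L)) + g -[1+ L ]) (Σ±-shift-up L g) ⟩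
  Σ± L g + g (+ suc L) + g (+ suc (suc L)) + g -[1+ L ]                ≡⟨ regroup′ (Σ± L g) (g (+ suc L)) _ _ ⟩
  Σ± L g + (g (+ suc L) + g -[1+ L ]) + g (+ suc (suc L))              ∎
  where
  open ≡-Reasoning
  g⁺ = λ k → g (k ℤ.+ 1ℤ)
  -[1+L]+1 : ∀ L → -[1+ L ] ℤ.+ 1ℤ ≡ ℤ.- + L
  -[1+L]+1 zero = refl
  -[1+L]+1 (suc L) = refl
  regroup : ∀ a b c d → a + (b + c) + d ≡ a + c + b + d
  regroup = solve 4 (λ a b c d → a :+ (b :+ c) :+ d := a :+ c :+ b :+ d) refl
    where open +-*-Solver
  regroup′ : ∀ a b c d → a + b + c + d ≡ a + (b + d) + c
  regroup′ = solve 4 (λ a b c d → a :+ b :+ c :+ d := a :+ (b :+ d) :+ c) refl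
    where open +-*-Solver

Σ±-shift-up-vanishing : ∀ L g → g -[1+ L ] ≡ 0 → g (+ suc L) ≡ 0 → g (+ suc (suc L)) ≡ 0 →
                        Σ± (suc L) (λ k → g (k ℤ.+ 1ℤ)) ≡ Σ± L g
Σ±-shift-up-vanishing L g g₋≡0 g₊≡0 g₊₊≡0 = begin
  Σ± (suc L) (λ k → g (k ℤ.+ 1ℤ))                     ≡⟨ +-identityʳ _ ⟨
  Σ± (suc L) (λ k → g (k ℤ.+ 1ℤ)) + 0                 ≡⟨ cong (_+_ (Σ± (suc L) (λ k → g (k ℤ.+ 1ℤ)))) g₋≡0 ⟨
  Σ± (suc L) (λ k → g (k ℤ.+ 1ℤ)) + g -[1+ L ]        ≡⟨ Σ±-shift-up (suc L) g ⟩
  Σ± (suc L) g + g (+ suc (suc L))                    ≡⟨ cong (_+_ (Σ± (suc L) g)) g₊₊≡0 ⟩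
  Σ± (suc L) g + 0                                    ≡⟨ +-identityʳ _ ⟩
  Σ± (suc L) g                                        ≡⟨ Σ±-suc-vanishing L g g₊≡0 g₋≡0 ⟩
  Σ± L g                                              ∎
  where open ≡-Reasoning

Σ±-shift-down-vanishing : ∀ L g → g (+ suc L) ≡ 0 → g -[1+ L ] ≡ 0 → g -[1+ suc L ] ≡ 0 →
                          Σ± (suc L) (λ k → g (k ℤ.- 1ℤ)) ≡ Σ± L g
Σ±-shift-down-vanishing L g g₊≡0 g₋≡0 g₋₋≡0 = begin
  Σ± (suc L) (λ k → g (k ℤ.- 1ℤ))                     ≡⟨ +-identityʳ _ ⟨
  Σ± (suc L) (λ k → g (k ℤ.- 1ℤ)) + 0                 ≡⟨ cong (_+_ (Σ± (suc L) (λ k → g (k ℤ.- 1ℤ)))) g₊≡0 ⟨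
  Σ± (suc L) (λ k → g (k ℤ.- 1ℤ)) + g (+ suc L)       ≡⟨ Σ±-shift-down (suc L) g ⟩
  Σ± (suc L) g + g -[1+ suc L ]                       ≡⟨ cong (_+_ (Σ± (suc L) g)) g₋₋≡0 ⟩
  Σ± (suc L) g + 0                                    ≡⟨ +-identityʳ _ ⟩
  Σ± (suc L) g                                        ≡⟨ Σ±-suc-vanishing L g g₊≡0 g₋≡0 ⟩
  Σ± L g                                              ∎
  where open ≡-Reasoning

-- The coefficient of q^n in JTP M at z = q^t.
JTP-at : ℤ → ℕ → ℤ → ℕ
JTP-at t M n = Σ± M (λ k → JTP M k (n ℤ.- t ℤ.* k))

JTP-at-suc : ∀ t M n → JTP-at t (suc M) n ≡ JTP-at t M n + JTP-at t M (n ℤ.- 4i+3 M ℤ.+ t)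
                                            + (JTP-at t M (n ℤ.- 4i+1 M ℤ.- t) + JTP-at t M (n ℤ.- 4i+1 M ℤ.- 4i+3 M))
JTP-at-suc t M n =
  trans (Σ±-cong (suc M) (λ k → ≐₂-at (JTP-suc M) k (n ℤ.- t ℤ.* k)))
  (trans (Σ±-+ (suc M) _ _) (cong₂ _+_ (trans (Σ±-+ (suc M) _ _) (cong₂ _+_ same up))
                                       (trans (Σ±-+ (suc M) _ _) (cong₂ _+_ down same′))))
  where
  open ℤSolver.+-*-Solver
  A = 4i+1 M
  B = 4i+3 M
  P = JTP M
  vanish₋ : ∀ x → P -[1+ M ] x ≡ 0
  vanish₋ = JTP-vanishes-below M 0
  vanish₋₋ : ∀ x → P -[1+ suc M ] x ≡ 0
  vanish₋₋ = JTP-vanishes-below M 1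
  vanish₊ : ∀ x → P (+ suc M) x ≡ 0
  vanish₊ = JTP-vanishes-above M 0
  vanish₊₊ : ∀ x → P (+ suc (suc M)) x ≡ 0
  vanish₊₊ = JTP-vanishes-above M 1
  same : Σ± (suc M) (λ k → P k (n ℤ.- t ℤ.* k)) ≡ JTP-at t M n
  same = Σ±-suc-vanishing M _ (vanish₊ _) (vanish₋ _)
  up-index : ∀ n t k B → n ℤ.- t ℤ.* k ℤ.- B ≡ n ℤ.- B ℤ.+ t ℤ.- t ℤ.* (k ℤ.+ 1ℤ)
  up-index = solve 4 (λ n t k B → n :- t :* k :- B := n :- B :+ t :- t :* (k :+ con 1ℤ)) refl
  up : Σ± (suc M) (λ k → P (k ℤ.- -1ℤ) (n ℤ.- t ℤ.* k ℤ.- B)) ≡ JTP-at t M (n ℤ.- B ℤ.+ t)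
  up = trans (Σ±-cong (suc M) (λ k → cong (P (k ℤ.+ 1ℤ)) (up-index n t k B)))
             (Σ±-shift-up-vanishing M (λ k → P k (n ℤ.- B ℤ.+ t ℤ.- t ℤ.* k)) (vanish₋ _) (vanish₊ _) (vanish₊₊ _))
  down-index : ∀ n t k A → n ℤ.- t ℤ.* k ℤ.- A ≡ n ℤ.- A ℤ.- t ℤ.- t ℤ.* (k ℤ.- 1ℤ)
  down-index = solve 4 (λ n t k A → n :- t :* k :- A := n :- A :- t :- t :* (k :- con 1ℤ)) refl
  down : Σ± (suc M) (λ k → P (k ℤ.- 1ℤ) (n ℤ.- t ℤ.* k ℤ.- A)) ≡ JTP-at t M (n ℤ.- A ℤ.- t)
  down = trans (Σ±-cong (suc M) (λ k → cong (P (k ℤ.- 1ℤ)) (down-index n t k A)))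
               (Σ±-shift-down-vanishing M (λ k → P k (n ℤ.- A ℤ.- t ℤ.- t ℤ.* k)) (vanish₊ _) (vanish₋ _) (vanish₋₋ _))
  same′-index : ∀ n t k A B → n ℤ.- t ℤ.* k ℤ.- A ℤ.- B ≡ n ℤ.- A ℤ.- B ℤ.- t ℤ.* k
  same′-index = solve 5 (λ n t k A B → n :- t :* k :- A :- B := n :- A :- B :- t :* k) refl
  same′ : Σ± (suc M) (λ k → P (k ℤ.- 1ℤ ℤ.- -1ℤ) (n ℤ.- t ℤ.* k ℤ.- A ℤ.- B)) ≡ JTP-at t M (n ℤ.- A ℤ.- B)
  same′ = trans (Σ±-cong (suc M) (λ k → cong₂ P (k-1+1≡k k) (same′-index n t k A B)))
                (Σ±-suc-vanishing M _ (vanish₊ _) (vanish₋ _))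

δ₂-0≡𝟙 : ∀ n → δ₂ 0ℤ n ≡ 𝟙 ⟨ n ⟩
δ₂-0≡𝟙 (+ zero) = refl
δ₂-0≡𝟙 (+ suc _) = refl
δ₂-0≡𝟙 -[1+ _ ] = refl

JTP-at-zero : ∀ t n → JTP-at t 0 n ≡ 𝟙 ⟨ n ⟩
JTP-at-zero t n = trans (cong (δ₂ 0ℤ) (trans (cong (ℤ._-_ n) (ℤP.*-zeroʳ t)) (ℤP.+-identityʳ n))) (δ₂-0≡𝟙 n)

module ΨProduct (c : ℕ) where
  open Mod c

  Σ±-resp-≋ : ∀ L {g g'} → (∀ j → j ≤ L → g (+ j) ≋ g' (+ j)) → (∀ j → j < L → g -[1+ j ] ≋ g' -[1+ j ]) →
              Σ± L g ≋ Σ± L g'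
  Σ±-resp-≋ zero e₊ e₋ = e₊ 0 z≤n
  Σ±-resp-≋ (suc L) e₊ e₋ = ≋-+ (Σ±-resp-≋ L (λ j j≤L → e₊ j (m≤n⇒m≤1+n j≤L)) (λ j j<L → e₋ j (m≤n⇒m≤1+n j<L)))
                                (≋-+ (e₊ (suc L) ≤-refl) (e₋ L ≤-refl))

  ×ψ[_]_ : ℕ → Series → Series
  ×ψ[ L ] f = series (λ n → Σ± L (λ k → f ⟨ n ℤ.- + k[2k-1] k ⟩))
    (λ x → Σ±-zero L _ (λ k → trans (cong (f ⟨_⟩) (-[1+k]-a≡-[1+k+a] x (k[2k-1] k))) (negative-coeff≡0 f _)))

  ×ψ-cong : ∀ L {f g} → f ≐ g → ×ψ[ L ] f ≐ ×ψ[ L ] g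
  ×ψ-cong L (mk≐ e) = mk≐ λ n → Σ±-cong L (λ k → e _)

  ×ψ-× : ∀ L a f → ×ψ[ L ] (×[1-q^ a ] f) ≐ ×[1-q^ a ] (×ψ[ L ] f)
  ×ψ-× L a f = mk≐ λ n → trans (Σ±-+ L _ _) (cong (_+_ ((×ψ[ L ] f) ⟨ n ⟩))
    (trans (Σ±-*ˡ L c _) (cong (_*_ c) (Σ±-cong L (λ k → cong (f ⟨_⟩) (ℤ-minus-comm n (+ k[2k-1] k) (+ a)))))))

-- T₂ modulo 2

module Mod2 where
  open Mod 1
  open FunctionalEquation 1
  open ΨProduct 1

  ×²≈×[2a] : ∀ a f {N} → fold f ×[1-q^ a ]_ 2 ≈[ N ] ×[1-q^ 2 * a ] f
  ×²≈×[2a] a f = mk≈ λ n _ → at n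
    where
    at : ∀ n → fold f ×[1-q^ a ]_ 2 ⟨ + n ⟩ ≋ (×[1-q^ 2 * a ] f) ⟨ + n ⟩
    at n = begin
      x0 + 1 * x1 + 1 * (x1 + 1 * x2)   ≡⟨ expand x0 x1 x2 ⟩
      x0 + 1 * x2 + x1 * 2              ≈⟨ x+y*modulus≋x (x0 + 1 * x2) x1 ⟩
      x0 + 1 * x2                       ≡⟨ cong (λ i → x0 + 1 * f ⟨ i ⟩) (ℤ-minus-2× (+ n) a) ⟩
      (×[1-q^ 2 * a ] f) ⟨ + n ⟩        ∎
      where
      open ≈-Reasoning ≋-setoid
      x0 = f ⟨ + n ⟩
      x1 = f ⟨ + n ℤ.- + a ⟩
      x2 = f ⟨ + n ℤ.- + a ℤ.- + a ⟩
      expand : ∀ x0 x1 x2 → x0 + 1 * x1 + 1 * (x1 + 1 * x2) ≡ x0 + 1 * x2 + x1 * 2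
      expand = solve 3 (λ x0 x1 x2 → x0 :+ con 1 :* x1 :+ con 1 :* (x1 :+ con 1 :* x2) := x0 :+ con 1 :* x2 :+ x1 :* con 2) refl
        where open +-*-Solver

  ×⁴≈×[4a] : ∀ a f {N} → fold f ×[1-q^ a ]_ 4 ≈[ N ] ×[1-q^ 4 * a ] f
  ×⁴≈×[4a] a f {N} = begin
    fold (fold f ×[1-q^ a ]_ 2) ×[1-q^ a ]_ 2   ≈⟨ ×²≈×[2a] a _ ⟩
    ×[1-q^ 2 * a ] (fold f ×[1-q^ a ]_ 2)        ≈⟨ ×-resp-≈ (2 * a) (×²≈×[2a] a f) ⟩
    fold f ×[1-q^ 2 * a ]_ 2                     ≈⟨ ×²≈×[2a] (2 * a) f ⟩
    ×[1-q^ 2 * (2 * a) ] f                       ≡⟨ cong (λ b → ×[1-q^ b ] f) (sym (*-assoc 2 2 a)) ⟩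
    ×[1-q^ 4 * a ] f                             ∎
    where open ≈-Reasoning (≈-setoid N)

  JTP-at-q⁰≡∏odd : ∀ M n → JTP-at 0ℤ M n ≡ (×∏[1-q^ odd < 2 * M ] 𝟙) ⟨ n ⟩
  JTP-at-q⁰≡∏odd zero n = JTP-at-zero 0ℤ n
  JTP-at-q⁰≡∏odd (suc M) n = begin
    JTP-at 0ℤ (suc M) n
      ≡⟨ JTP-at-suc 0ℤ M n ⟩
    Y n + Y (n ℤ.- B ℤ.+ 0ℤ) + (Y (n ℤ.- A ℤ.- 0ℤ) + Y (n ℤ.- A ℤ.- B))
      ≡⟨ cong₂ (λ x y → Y n + Y x + (Y y + Y (n ℤ.- A ℤ.- B))) (ℤP.+-identityʳ (n ℤ.- B)) (ℤP.+-identityʳ (n ℤ.- A)) ⟩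
    Y n + Y (n ℤ.- B) + (Y (n ℤ.- A) + Y (n ℤ.- A ℤ.- B))
      ≡⟨ cong (λ x → Y n + Y (n ℤ.- B) + (Y (n ℤ.- A) + Y x)) (ℤ-minus-comm n A B) ⟩
    Y n + Y (n ℤ.- B) + (Y (n ℤ.- A) + Y (n ℤ.- B ℤ.- A))
      ≡⟨ regroup (Y n) _ _ _ ⟩
    Y n + 1 * Y (n ℤ.- A) + 1 * (Y (n ℤ.- B) + 1 * Y (n ℤ.- B ℤ.- A))
      ≡⟨ cong₂ _+_ (cong₂ _+_ (Y≡X n) (cong (_*_ 1) (Y≡X _))) (cong (_*_ 1) (cong₂ _+_ (Y≡X _) (cong (_*_ 1) (Y≡X _)))) ⟩
    X n + 1 * X (n ℤ.- A) + 1 * (X (n ℤ.- B) + 1 * X (n ℤ.- B ℤ.- A))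
      ≡⟨ cong₂ (λ a b → X n + 1 * X (n ℤ.- a) + 1 * (X (n ℤ.- b) + 1 * X (n ℤ.- b ℤ.- a))) A≡odd B≡odd ⟩
    (×∏[1-q^ odd < suc (suc (2 * M)) ] 𝟙) ⟨ n ⟩
      ≡⟨ cong (λ K → (×∏[1-q^ odd < K ] 𝟙) ⟨ n ⟩) (*-suc 2 M) ⟨
    (×∏[1-q^ odd < 2 * suc M ] 𝟙) ⟨ n ⟩  ∎
    where
    open ≡-Reasoning
    A = 4i+1 M
    B = 4i+3 M
    X = (×∏[1-q^ odd < 2 * M ] 𝟙) ⟨_⟩
    Y = JTP-at 0ℤ M
    Y≡X : ∀ x → Y x ≡ X x
    Y≡X = JTP-at-q⁰≡∏odd M
    regroup : ∀ x y z w → x + y + (z + w) ≡ x + 1 * z + 1 * (y + 1 * w)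
    regroup = solve 4 (λ x y z w → x :+ y :+ (z :+ w) := x :+ con 1 :* z :+ con 1 :* (y :+ con 1 :* w)) refl
      where open +-*-Solver
    A≡odd : A ≡ + odd (2 * M)
    A≡odd = cong (λ m → + (m + 1)) (*-assoc 2 2 M)
    B≡odd : B ≡ + odd (suc (2 * M))
    B≡odd = cong +_ (solve 1 (λ M → con 4 :* M :+ con 3 := con 2 :* (con 1 :+ con 2 :* M) :+ con 1) refl M)
      where open +-*-Solver

  JTP-at-q¹≋∏4odd : ∀ M n → JTP-at 1ℤ M n ≋ (×∏[1-q^ (λ i → 4 * odd i) < M ] 𝟙) ⟨ n ⟩
  JTP-at-q¹≋∏4odd zero n = ≋-reflexive (JTP-at-zero 1ℤ n)
  JTP-at-q¹≋∏4odd (suc M) n = begin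
    JTP-at 1ℤ (suc M) n
      ≡⟨ JTP-at-suc 1ℤ M n ⟩
    Y n + Y (n ℤ.- B ℤ.+ 1ℤ) + (Y (n ℤ.- A ℤ.- 1ℤ) + Y (n ℤ.- A ℤ.- B))
      ≡⟨ cong₂ (λ x y → Y n + Y x + (Y (n ℤ.- A ℤ.- 1ℤ) + Y y)) (middle n (+ (4 * M))) (both n A B) ⟩
    Y n + Y (n ℤ.- A ℤ.- 1ℤ) + (Y (n ℤ.- A ℤ.- 1ℤ) + Y (n ℤ.- (A ℤ.+ B)))
      ≡⟨ regroup (Y n) _ _ ⟩
    Y n + 1 * Y (n ℤ.- (A ℤ.+ B)) + Y (n ℤ.- A ℤ.- 1ℤ) * 2
      ≈⟨ x+y*modulus≋x _ (Y (n ℤ.- A ℤ.- 1ℤ)) ⟩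
    Y n + 1 * Y (n ℤ.- (A ℤ.+ B))
      ≈⟨ ≋-+ (JTP-at-q¹≋∏4odd M n) (≋-* (≋-refl {1}) (JTP-at-q¹≋∏4odd M _)) ⟩
    X n + 1 * X (n ℤ.- (A ℤ.+ B))
      ≡⟨ cong (λ m → X n + 1 * X (n ℤ.- + m)) A+B≡4*odd ⟩
    (×∏[1-q^ (λ i → 4 * odd i) < suc M ] 𝟙) ⟨ n ⟩ ∎
    where
    open ≈-Reasoning ≋-setoid
    A = 4i+1 M
    B = 4i+3 M
    X = (×∏[1-q^ (λ i → 4 * odd i) < M ] 𝟙) ⟨_⟩
    Y = JTP-at 1ℤ M
    middle : ∀ n W → n ℤ.- (W ℤ.+ + 3) ℤ.+ 1ℤ ≡ n ℤ.- (W ℤ.+ + 1) ℤ.- 1ℤ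
    middle = solve 2 (λ n W → n :- (W :+ con (+ 3)) :+ con 1ℤ := n :- (W :+ con (+ 1)) :- con 1ℤ) refl
      where open ℤSolver.+-*-Solver
    both : ∀ n A B → n ℤ.- A ℤ.- B ≡ n ℤ.- (A ℤ.+ B)
    both = solve 3 (λ n A B → n :- A :- B := n :- (A :+ B)) refl
      where open ℤSolver.+-*-Solver
    regroup : ∀ x y z → x + y + (y + z) ≡ x + 1 * z + y * 2
    regroup = solve 3 (λ x y z → x :+ y :+ (y :+ z) := x :+ con 1 :* z :+ y :* con 2) refl
      where open +-*-Solver
    A+B≡4*odd : 4 * M + 1 + (4 * M + 3) ≡ 4 * odd M
    A+B≡4*odd = solve 1 (λ M → con 4 :* M :+ con 1 :+ (con 4 :* M :+ con 3) := con 4 :* (con 2 :* M :+ con 1)) refl M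
      where open +-*-Solver

  -- The summands for k = L + 1 and k = -(L + 1) coincide, so they cancel modulo 2.
  Σ±-pairing : ∀ L (g : ℤ → ℕ) m → Σ± L (λ k → g (m ℤ.- k ℤ.- + k[2k-1] k)) ≋ g m
  Σ±-pairing zero g m = ≋-reflexive (cong g (trans (ℤP.+-identityʳ _) (ℤP.+-identityʳ m)))
  Σ±-pairing (suc L) g m = begin
    Σ± L G + (y + G -[1+ L ])            ≡⟨ cong (λ i → Σ± L G + (y + g i)) index ⟩
    Σ± L G + (y + y)                     ≡⟨ cong (λ z → Σ± L G + (y + z)) (*-identityˡ y) ⟨
    Σ± L G + (y + 1 * y)                 ≡⟨ +-assoc (Σ± L G) y (1 * y) ⟨
    Σ± L G + y + 1 * y                   ≈⟨ x+y+cy≋x (Σ± L G) y ⟩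
    Σ± L G                               ≈⟨ Σ±-pairing L g m ⟩
    g m                                  ∎
    where
    open ≈-Reasoning ≋-setoid
    G = λ k → g (m ℤ.- k ℤ.- + k[2k-1] k)
    y = G (+ suc L)
    k[2k-1]-pair : ∀ L → k[2k-1] -[1+ L ] ≡ suc L + suc L + k[2k-1] (+ suc L)
    k[2k-1]-pair = solve 1 (λ L → (con 1 :+ L) :* (con 2 :* L :+ con 3)
                                := (con 1 :+ L) :+ (con 1 :+ L) :+ (con 1 :+ L) :* (con 1 :+ con 2 :* L)) refl
      where open +-*-Solver
    m+S-[S+S+E] : ∀ m S E → m ℤ.+ S ℤ.- (S ℤ.+ S ℤ.+ E) ≡ m ℤ.- S ℤ.- E
    m+S-[S+S+E] = solve 3 (λ m S E → m :+ S :- (S :+ S :+ E) := m :- S :- E) refl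
      where open ℤSolver.+-*-Solver
    index : m ℤ.- -[1+ L ] ℤ.- + k[2k-1] -[1+ L ] ≡ m ℤ.- + suc L ℤ.- + k[2k-1] (+ suc L)
    index = trans (cong (λ e → m ℤ.- -[1+ L ] ℤ.- + e) (k[2k-1]-pair L)) (m+S-[S+S+E] m (+ suc L) (+ k[2k-1] (+ suc L)))

  JTP-constant-term : ∀ M m d → m ℤ.+ + suc d ≡ + (3 * M) → JTP M 0ℤ m ≋ (×∏[1-q^ (λ i → 4 * odd i) < M ] 𝟙) ⟨ m ⟩
  JTP-constant-term M m d h = begin
    JTP M 0ℤ m                                              ≈⟨ Σ±-pairing M (JTP M 0ℤ) m ⟨
    Σ± M (λ k → JTP M 0ℤ (m ℤ.- k ℤ.- + k[2k-1] k))          ≈⟨ Σ±-resp-≋ M (λ j _ → ≋-sym (reduce₊ j)) (λ j j<M → ≋-sym (reduce₋ j j<M)) ⟩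
    Σ± M (λ k → JTP M k (m ℤ.- k))                          ≡⟨ Σ±-cong M (λ k → cong (λ x → JTP M k (m ℤ.- x)) (ℤP.*-identityˡ k)) ⟨
    JTP-at 1ℤ M m                                           ≈⟨ JTP-at-q¹≋∏4odd M m ⟩
    (×∏[1-q^ (λ i → 4 * odd i) < M ] 𝟙) ⟨ m ⟩                ∎
    where
    open ≈-Reasoning ≋-setoid
    open ℤSolver.+-*-Solver
    witness₊ : ∀ m D J W → m ℤ.- J ℤ.+ (+ 1 ℤ.+ (D ℤ.+ J ℤ.+ W)) ≡ W ℤ.+ (m ℤ.+ (+ 1 ℤ.+ D))
    witness₊ = solve 4 (λ m D J W → m :- J :+ (con (+ 1) :+ (D :+ J :+ W)) := W :+ (m :+ (con (+ 1) :+ D))) refl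
    reduce₊ : ∀ j → JTP M (+ j) (m ℤ.- + j) ≋ JTP M 0ℤ (m ℤ.- + j ℤ.- + k[2k-1] (+ j))
    reduce₊ j = JTP-reduce M (+ j) (m ℤ.- + j) (d + j + M) (trans (witness₊ m (+ d) (+ j) (+ M)) (cong (ℤ._+_ (+ M)) h))
    witness₋ : ∀ m D J R → m ℤ.- ℤ.- (+ 1 ℤ.+ J) ℤ.+ (+ 1 ℤ.+ (D ℤ.+ R)) ≡ (+ 1 ℤ.+ J ℤ.+ R) ℤ.+ (m ℤ.+ (+ 1 ℤ.+ D))
    witness₋ = solve 4 (λ m D J R → m :- (:- (con (+ 1) :+ J)) :+ (con (+ 1) :+ (D :+ R)) := (con (+ 1) :+ J :+ R) :+ (m :+ (con (+ 1) :+ D))) refl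
    reduce₋ : ∀ j → j < M → JTP M -[1+ j ] (m ℤ.- -[1+ j ]) ≋ JTP M 0ℤ (m ℤ.- -[1+ j ] ℤ.- + k[2k-1] -[1+ j ])
    reduce₋ j j<M = JTP-reduce M -[1+ j ] (m ℤ.- -[1+ j ]) (d + (M ∸ suc j))
      (trans (witness₋ m (+ d) (+ j) (+ (M ∸ suc j))) (cong₂ ℤ._+_ (cong +_ (m+[n∸m]≡n j<M)) h))

  ∏odd≈×ψ∏4odd : ∀ {N M} → N < 3 * M → ×∏[1-q^ odd < 2 * M ] 𝟙 ≈[ N ] ×ψ[ M ] ×∏[1-q^ (λ i → 4 * odd i) < M ] 𝟙
  ∏odd≈×ψ∏4odd {N} {M} N<3M = mk≈ λ n n≤N → begin
    (×∏[1-q^ odd < 2 * M ] 𝟙) ⟨ + n ⟩                          ≡⟨ JTP-at-q⁰≡∏odd M (+ n) ⟨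
    Σ± M (λ k → JTP M k (+ n ℤ.- 0ℤ ℤ.* k))                    ≈⟨ Σ±-resp-≋ M (λ j _ → step n≤N (+ j)) (λ j _ → step n≤N -[1+ j ]) ⟩
    Σ± M (λ k → P ⟨ + n ℤ.- + k[2k-1] k ⟩)                     ∎
    where
    open ≈-Reasoning ≋-setoid
    P = ×∏[1-q^ (λ i → 4 * odd i) < M ] 𝟙
    step : ∀ {n} → n ≤ N → ∀ k → JTP M k (+ n ℤ.- 0ℤ ℤ.* k) ≋ P ⟨ + n ℤ.- + k[2k-1] k ⟩
    step {n} n≤N k = begin
      JTP M k (+ n ℤ.- 0ℤ ℤ.* k)           ≡⟨ cong (λ x → JTP M k (+ n ℤ.- x)) (ℤP.*-zeroˡ k) ⟩
      JTP M k (+ n ℤ.+ 0ℤ)                 ≡⟨ cong (JTP M k) (ℤP.+-identityʳ (+ n)) ⟩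
      JTP M k (+ n)                        ≈⟨ JTP-reduce M k (+ n) (4 * M ∸ suc n) (cong +_ (trans (+-suc n _) (m+[n∸m]≡n n<4M))) ⟩
      JTP M 0ℤ (+ n ℤ.- + k[2k-1] k)       ≈⟨ JTP-constant-term M _ (3 * M ∸ suc n + k[2k-1] k) h ⟩
      P ⟨ + n ℤ.- + k[2k-1] k ⟩            ∎
      where
      n<3M : n < 3 * M
      n<3M = ≤-<-trans n≤N N<3M
      n<4M : n < 4 * M
      n<4M = <-≤-trans n<3M (m≤n+m (3 * M) M)
      witness : ∀ N E R → N ℤ.- E ℤ.+ (+ 1 ℤ.+ (R ℤ.+ E)) ≡ N ℤ.+ (+ 1 ℤ.+ R)
      witness = solve 3 (λ N E R → N :- E :+ (con (+ 1) :+ (R :+ E)) := N :+ (con (+ 1) :+ R)) refl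
        where open ℤSolver.+-*-Solver
      h : + n ℤ.- + k[2k-1] k ℤ.+ + suc (3 * M ∸ suc n + k[2k-1] k) ≡ + (3 * M)
      h = trans (witness (+ n) (+ k[2k-1] k) (+ (3 * M ∸ suc n))) (cong +_ (trans (+-suc n _) (m+[n∸m]≡n n<3M)))

  8k[2k-1]+1-square : ∀ k → Σ ℕ (λ x → x * x ≡ 8 * k[2k-1] k + 1)
  8k[2k-1]+1-square (+ zero) = 1 , refl
  8k[2k-1]+1-square (+ suc i) = 3 + 4 * i ,
    solve 1 (λ i → (con 3 :+ con 4 :* i) :* (con 3 :+ con 4 :* i) := con 8 :* ((con 1 :+ i) :* (con 1 :+ con 2 :* i)) :+ con 1) refl i
    where open +-*-Solver
  8k[2k-1]+1-square -[1+ i ] = 5 + 4 * i ,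
    solve 1 (λ i → (con 5 :+ con 4 :* i) :* (con 5 :+ con 4 :* i) := con 8 :* ((con 1 :+ i) :* (con 2 :* i :+ con 3)) :+ con 1) refl i
    where open +-*-Solver

  𝟙⟨N-e⟩≡0 : ∀ N e → e ≢ N → 𝟙 ⟨ + N ℤ.- + e ⟩ ≡ 0
  𝟙⟨N-e⟩≡0 N e e≢N = at (minus-view N e)
    where
    at : ∀ {i} → MinusView N e i → 𝟙 ⟨ i ⟩ ≡ 0
    at (≥-view e≤N) with N ∸ e in eq
    ... | zero = contradiction (≤-antisym e≤N (m∸n≡0⇒m≤n eq)) e≢N
    ... | suc _ = refl
    at (<-view _) = refl

  T₂≈ψ : ∀ {N M} → N < M → T₂ ≈[ N ] ×ψ[ M ] 𝟙
  T₂≈ψ {N} {M} N<M = fold-cancel {P} (∏-cancel odd 1≤odd M) 4 {T₂} {×ψ[ M ] 𝟙} (begin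
    P (fold T₂ P 3)                                         ≈⟨ ∏-resp-≈ odd M (∏³-T₂ (<⇒≤ N<M)) ⟩
    P 𝟙                                                     ≈⟨ ∏-below odd M M (λ i M≤i → <-≤-trans N<M (≤-trans M≤i (≤-trans (m≤n*m i 2) (m≤m+n (2 * i) 1)))) ⟨
    ×∏[1-q^ odd < M + M ] 𝟙                                 ≡⟨ cong (λ K → ×∏[1-q^ odd < K ] 𝟙) (cong (_+_ M) (+-identityʳ M)) ⟨
    ×∏[1-q^ odd < 2 * M ] 𝟙                                 ≈⟨ ∏odd≈×ψ∏4odd {N} {M} (<-≤-trans N<M (m≤n*m M 3)) ⟩
    ×ψ[ M ] (×∏[1-q^ (λ i → 4 * odd i) < M ] 𝟙)             ≈⟨ ≐⇒≈ (∏-natural (λ i → 4 * odd i) ×ψ[ M ]_ (×ψ-cong M) (×ψ-× M) M 𝟙) ⟩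
    ×∏[1-q^ (λ i → 4 * odd i) < M ] (×ψ[ M ] 𝟙)             ≈⟨ ∏-frobenius 4 ×⁴≈×[4a] odd M (×ψ[ M ] 𝟙) ⟨
    fold (×ψ[ M ] 𝟙) P 4                                    ∎)
    where
    open Euler 1
    open ≈-Reasoning (≈-setoid N)
    P : Series → Series
    P = ×∏[1-q^ odd < M ]_

  T2-mod2 : ∀ N → (∀ x → x * x ≢ 8 * N + 1) → 2 ∣ T2 N
  T2-mod2 N non-square = m%n≡0⇒n∣m (T2 N) 2 (%-≡ (≋-trans (≈-at (T₂≈ψ (n<1+n N)) N ≤-refl) (≋-reflexive (ψ⟨N⟩≡0 (suc N)))))
    where
    ψ⟨N⟩≡0 : ∀ M → (×ψ[ M ] 𝟙) ⟨ + N ⟩ ≡ 0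
    ψ⟨N⟩≡0 M = Σ±-zero M (λ k → 𝟙 ⟨ + N ℤ.- + k[2k-1] k ⟩) λ k → 𝟙⟨N-e⟩≡0 N (k[2k-1] k) λ e≡N →
      non-square (proj₁ (8k[2k-1]+1-square k)) (trans (proj₂ (8k[2k-1]+1-square k)) (cong (λ e → 8 * e + 1) e≡N))

-- Arithmetic of 8N + 1

prime∣x*x⇒prime∣x : ∀ {q} x → Prime q → q ∣ x * x → q ∣ x
prime∣x*x⇒prime∣x x q-prime q∣x*x with euclidsLemma x x q-prime q∣x*x
... | inj₁ q∣x = q∣x
... | inj₂ q∣x = q∣x

square≡q²z⇒square≡z : ∀ {q z} x → Prime q → x * x ≡ q * q * z → Σ ℕ (λ x' → x' * x' ≡ z)
square≡q²z⇒square≡z {q} {z} x q-prime x²≡q²z with prime∣x*x⇒prime∣x x q-prime (divides (q * z) (trans x²≡q²z (rearrange q z)))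
  where
  rearrange : ∀ q z → q * q * z ≡ q * z * q
  rearrange = solve 2 (λ q z → q :* q :* z := q :* z :* q) refl
    where open +-*-Solver
... | divides a refl = a , *-cancelˡ-≡ (a * a) z (q * q) (trans (rearrange a q) x²≡q²z)
  where
  instance
    q*q≢0 : NonZero (q * q)
    q*q≢0 = m*n≢0 q q {{prime⇒nonZero q-prime}} {{prime⇒nonZero q-prime}}
  rearrange : ∀ a q → q * q * (a * a) ≡ a * q * (a * q)
  rearrange = solve 2 (λ a q → q :* q :* (a :* a) := a :* q :* (a :* q)) refl
    where open +-*-Solver

square≢p*y : ∀ {p y} x → Prime p → ¬ p ∣ y → x * x ≢ p * y
square≢p*y {p} {y} x p-prime p∤y x²≡py with prime∣x*x⇒prime∣x x p-prime (divides y (trans x²≡py (*-comm p y)))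
... | divides a refl = p∤y (divides (a * a) (*-cancelˡ-≡ y (a * a * p) p {{prime⇒nonZero p-prime}} (sym (trans (rearrange a p) x²≡py))))
  where
  rearrange : ∀ a p → p * (a * a * p) ≡ a * p * (a * p)
  rearrange = solve 2 (λ a p → p :* (a :* a :* p) := a :* p :* (a :* p)) refl
    where open +-*-Solver

square≢primes²*p*y : ∀ {p y k} (qs : Vec ℕ k) → All Prime qs → Prime p → ¬ p ∣ y →
                     ∀ x → x * x ≢ prodV qs * prodV qs * (p * y)
square≢primes²*p*y [] [] p-prime p∤y x x²≡ = square≢p*y x p-prime p∤y (trans x²≡ (+-identityʳ _))
square≢primes²*p*y {p} {y} (q ∷ qs) (q-prime ∷ qs-prime) p-prime p∤y x x²≡ =
  let x' , x'²≡ = square≡q²z⇒square≡z x q-prime (trans x²≡ (rearrange q (prodV qs) (p * y)))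
  in square≢primes²*p*y qs qs-prime p-prime p∤y x' x'²≡
  where
  rearrange : ∀ q A z → q * A * (q * A) * z ≡ q * q * (A * A * z)
  rearrange = solve 3 (λ q A z → q :* A :* (q :* A) :* z := q :* q :* (A :* A :* z)) refl
    where open +-*-Solver

prime≥5∤8 : ∀ {p} → Prime p → 5 ≤ p → ¬ p ∣ 8
prime≥5∤8 {p} p-prime 5≤p p∣8 = [ p∤2 , [ p∤2 , p∤2 ]′ ∘ euclidsLemma 2 2 p-prime ]′ (euclidsLemma 2 4 p-prime p∣8)
  where
  p∤2 : ¬ p ∣ 2
  p∤2 p∣2 = <⇒≱ (≤-trans (s≤s (s≤s (s≤s z≤n))) 5≤p) (∣⇒≤ p∣2)

8[Qa+m]+1≡Q[8[a+j]+p] : ∀ Q a m j p → + 8 ℤ.* m ℤ.+ + 1 ≡ Q ℤ.* (+ 8 ℤ.* j ℤ.+ p) →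
                        + 8 ℤ.* (Q ℤ.* a ℤ.+ m) ℤ.+ + 1 ≡ Q ℤ.* (+ 8 ℤ.* (a ℤ.+ j) ℤ.+ p)
8[Qa+m]+1≡Q[8[a+j]+p] Q a m j p h = begin
  + 8 ℤ.* (Q ℤ.* a ℤ.+ m) ℤ.+ + 1            ≡⟨ split Q a m ⟩
  Q ℤ.* (+ 8 ℤ.* a) ℤ.+ (+ 8 ℤ.* m ℤ.+ + 1)   ≡⟨ cong (ℤ._+_ (Q ℤ.* (+ 8 ℤ.* a))) h ⟩
  Q ℤ.* (+ 8 ℤ.* a) ℤ.+ Q ℤ.* (+ 8 ℤ.* j ℤ.+ p) ≡⟨ merge Q a j p ⟩
  Q ℤ.* (+ 8 ℤ.* (a ℤ.+ j) ℤ.+ p)             ∎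
  where
  open ≡-Reasoning
  open ℤSolver.+-*-Solver
  split : ∀ Q a m → + 8 ℤ.* (Q ℤ.* a ℤ.+ m) ℤ.+ + 1 ≡ Q ℤ.* (+ 8 ℤ.* a) ℤ.+ (+ 8 ℤ.* m ℤ.+ + 1)
  split = solve 3 (λ Q a m → con (+ 8) :* (Q :* a :+ m) :+ con (+ 1) := Q :* (con (+ 8) :* a) :+ (con (+ 8) :* m :+ con (+ 1))) refl
  merge : ∀ Q a j p → Q ℤ.* (+ 8 ℤ.* a) ℤ.+ Q ℤ.* (+ 8 ℤ.* j ℤ.+ p) ≡ Q ℤ.* (+ 8 ℤ.* (a ℤ.+ j) ℤ.+ p)
  merge = solve 4 (λ Q a j p → Q :* (con (+ 8) :* a) :+ Q :* (con (+ 8) :* j :+ p) := Q :* (con (+ 8) :* (a :+ j) :+ p)) refl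

p∣8[pn+j]+p⇒p∣8j : ∀ p n j → + p ℤS.∣ + 8 ℤ.* (+ (p * n) ℤ.+ j) ℤ.+ + p → + p ℤS.∣ + 8 ℤ.* j
p∣8[pn+j]+p⇒p∣8j p n j p∣Y = subst (+ p ℤS.∣_) (sym 8j≡Y-p[8n+1]) (ℤS.∣m∣n⇒∣m-n p∣Y (ℤS.∣m⇒∣m*n (+ 8 ℤ.* + n ℤ.+ + 1) ℤS.∣-refl))
  where
  open ℤSolver.+-*-Solver
  identity : ∀ p n j → + 8 ℤ.* j ≡ + 8 ℤ.* (p ℤ.* n ℤ.+ j) ℤ.+ p ℤ.- p ℤ.* (+ 8 ℤ.* n ℤ.+ + 1)
  identity = solve 3 (λ p n j → con (+ 8) :* j := con (+ 8) :* (p :* n :+ j) :+ p :- p :* (con (+ 8) :* n :+ con (+ 1))) refl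
  8j≡Y-p[8n+1] : + 8 ℤ.* j ≡ + 8 ℤ.* (+ (p * n) ℤ.+ j) ℤ.+ + p ℤ.- + p ℤ.* (+ 8 ℤ.* + n ℤ.+ + 1)
  8j≡Y-p[8n+1] = trans (identity (+ p) (+ n) j)
                       (cong (λ pn → + 8 ℤ.* (pn ℤ.+ j) ℤ.+ + p ℤ.- + p ℤ.* (+ 8 ℤ.* + n ℤ.+ + 1)) (sym (ℤP.pos-* p n)))

p∤∣8[pn+j]+p∣ : ∀ {p} n j → Prime p → ¬ p ∣ 8 → ¬ p ∣ ℤ.∣ j ∣ → ¬ p ∣ ℤ.∣ + 8 ℤ.* (+ (p * n) ℤ.+ j) ℤ.+ + p ∣
p∤∣8[pn+j]+p∣ {p} n j p-prime p∤8 p∤j p∣Y = [ p∤8 , p∤j ]′ (euclidsLemma 8 ℤ.∣ j ∣ p-prime p∣8*∣j∣)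
  where
  p∣∣8j∣ : p ∣ ℤ.∣ + 8 ℤ.* j ∣
  p∣∣8j∣ = ℤS.∣⇒∣ᵤ (p∣8[pn+j]+p⇒p∣8j p n j (ℤS.∣ᵤ⇒∣ {+ p} {+ 8 ℤ.* (+ (p * n) ℤ.+ j) ℤ.+ + p} p∣Y))
  p∣8*∣j∣ : p ∣ 8 * ℤ.∣ j ∣
  p∣8*∣j∣ = subst (p ∣_) (ℤP.abs-* (+ 8) j) p∣∣8j∣

2∣∧3∣⇒6∣ : ∀ {T} → 2 ∣ T → 3 ∣ T → 6 ∣ T
2∣∧3∣⇒6∣ 2∣T (divides t refl) with euclidsLemma t 3 prime[2] 2∣T
... | inj₁ (divides s refl) = divides s (*-assoc s 2 3)
... | inj₂ 2∣3 = contradiction (n∣m⇒m%n≡0 3 2 2∣3) (λ ())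

prime[3] : Prime 3
prime[3] = toWitness {a? = prime? 3} _

8N+1≡[3P]²py : ∀ {N n p P m j} → + 8 ℤ.* m ℤ.+ + 1 ≡ + (9 * P ^ 2 * p) ℤ.* (+ 8 ℤ.* j ℤ.+ + p) →
               + (9 * P ^ 2 * p ^ 2 * n) ℤ.+ m ≡ + N →
               8 * N + 1 ≡ 3 * P * (3 * P) * (p * ℤ.∣ + 8 ℤ.* (+ (p * n) ℤ.+ j) ℤ.+ + p ∣)
8N+1≡[3P]²py {N} {n} {p} {P} {m} {j} hm X≡N = begin
  8 * N + 1                                        ≡⟨ cong ℤ.∣_∣ +[8N+1]≡QY ⟩
  ℤ.∣ + Q ℤ.* Y ∣                                  ≡⟨ ℤP.abs-* (+ Q) Y ⟩
  Q * ℤ.∣ Y ∣                                      ≡⟨ Q*y≡[3P]²py P p ℤ.∣ Y ∣ ⟩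
  3 * P * (3 * P) * (p * ℤ.∣ Y ∣)                  ∎
  where
  open ≡-Reasoning
  Q = 9 * P ^ 2 * p
  Y = + 8 ℤ.* (+ (p * n) ℤ.+ j) ℤ.+ + p
  9P²p²n≡Q*pn : ∀ P p n → 9 * (P * (P * 1)) * (p * (p * 1)) * n ≡ 9 * (P * (P * 1)) * p * (p * n)
  9P²p²n≡Q*pn = solve 3 (λ P p n → con 9 :* (P :* (P :* con 1)) :* (p :* (p :* con 1)) :* n
                                 := con 9 :* (P :* (P :* con 1)) :* p :* (p :* n)) refl
    where open +-*-Solver
  Q*y≡[3P]²py : ∀ P p y → 9 * (P * (P * 1)) * p * y ≡ 3 * P * (3 * P) * (p * y)
  Q*y≡[3P]²py = solve 3 (λ P p y → con 9 :* (P :* (P :* con 1)) :* p :* y := con 3 :* P :* (con 3 :* P) :* (p :* y)) refl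
    where open +-*-Solver
  X≡Q*pn+m : + N ≡ + Q ℤ.* + (p * n) ℤ.+ m
  X≡Q*pn+m = trans (sym X≡N) (cong (ℤ._+ m) (trans (cong +_ (9P²p²n≡Q*pn P p n)) (ℤP.pos-* Q (p * n))))
  +[8N+1]≡QY : + (8 * N + 1) ≡ + Q ℤ.* Y
  +[8N+1]≡QY = trans (cong (λ x → x ℤ.+ + 1) (trans (ℤP.pos-* 8 N) (cong (ℤ._*_ (+ 8)) X≡Q*pn+m)))
                     (8[Qa+m]+1≡Q[8[a+j]+p] (+ Q) (+ (p * n)) m j (+ p) hm)

8N+1≡[3A]²B⇒3∤N : ∀ {N A B} → 8 * N + 1 ≡ 3 * A * (3 * A) * B → ¬ 3 ∣ N
8N+1≡[3A]²B⇒3∤N {N} {A} {B} 8N+1≡ 3∣N = contradiction (∣1⇒≡1 (∣m+n∣m⇒∣n 3∣8N+1 (∣-trans 3∣N (n∣m*n 8)))) λ ()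
  where
  3∣8N+1 : 3 ∣ 8 * N + 1
  3∣8N+1 = subst (3 ∣_) (sym 8N+1≡) (∣-trans (∣-trans (m∣m*n A) (m∣m*n (3 * A))) (m∣m*n B))

theorem1p9 : (k n : ℕ) (ps : Vec ℕ k) (p : ℕ) →
    All (λ q → Prime q × 5 ≤ q × ¬ (q % 8 ≡ 1)) ps →
    Prime p → 5 ≤ p → ¬ (p % 8 ≡ 1) →
    (j : ℤ) → ¬ ((+ p) ℤD.∣ j) →
    (m : ℤ) →
    ℤ._*_ (+ 8) m ℤ.+ + 1
      ≡ ℤ._*_ (+ (9 * prodV ps ^ 2 * p)) (ℤ._*_ (+ 8) j ℤ.+ + p) →
    6 ∣ T2ℤ (+ (9 * prodV ps ^ 2 * p ^ 2 * n) ℤ.+ m)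
theorem1p9 k n ps p ps-prime p-prime 5≤p _ j p∤j m hm with + (9 * prodV ps ^ 2 * p ^ 2 * n) ℤ.+ m in X≡N
... | -[1+ _ ] = 6 ∣0
... | + N = 2∣∧3∣⇒6∣ (Mod2.T2-mod2 N non-square) (Mod3.T2-mod3 N (8N+1≡[3A]²B⇒3∤N {N} {prodV ps} 8N+1≡))
  where
  y = ℤ.∣ + 8 ℤ.* (+ (p * n) ℤ.+ j) ℤ.+ + p ∣
  8N+1≡ : 8 * N + 1 ≡ 3 * prodV ps * (3 * prodV ps) * (p * y)
  8N+1≡ = 8N+1≡[3P]²py {N} {n} {p} {prodV ps} {m} {j} hm X≡N
  non-square : ∀ x → x * x ≢ 8 * N + 1
  non-square x x²≡ = square≢primes²*p*y (3 ∷ ps) (prime[3] ∷ All.map proj₁ ps-prime) p-prime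
    (p∤∣8[pn+j]+p∣ n j p-prime (prime≥5∤8 p-prime 5≤p) p∤j) x (trans x²≡ 8N+1≡)
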